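{- Let $p$ be a prime with $p\equiv 15$ or $27\pmod{28}$. For all integers $n,k\geq 0$ with $p\nmid n$, \[ c_{11,3}\left(8p^{2k+1}n+\frac{122p^{2k+2}+4}{7}\right)\equiv 0\pmod 2. \]
   Context: For complex $a,b$ the false theta function is $\Psi(a,b):=\sum_{n=0}^\infty a^{n(n+1)/2}b^{n(n-1)/2}-\sum_{n=-\infty}^{ -1}a^{n(n+1)/2}b^{n(n-1)/2}$. For positive integers $r,s$, the integers $c_{r,s}(n)$ ($n\ge 0$) are defined by the power series identity $\sum_{n=0}^\infty c_{r,s}(n)q^n=\dfrac{1}{\Psi(-q^r,q^s)}$ (the denominator is a power series in $q$ with constant term $1$). -}

module Defs where

open import Data.Nat as ℕ using (ℕ; zero; suc; _≡ᵇ_)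
open import Data.Nat.DivMod using (_/_; _%_)
open import Data.Integer as ℤ using (ℤ; +_; -_)
open import Data.List using (List; []; _∷_; map; foldr; zipWith; upTo)
open import Data.Bool using (if_then_else_)

sumℤ : List ℤ → ℤ
sumℤ = foldr ℤ._+_ ℤ.0ℤ

sgn : ℕ → ℤ
sgn k = if (k % 2) ≡ᵇ 0 then ℤ.1ℤ else ℤ.-1ℤ

tri : ℕ → ℕ
tri n = (n ℕ.* suc n) / 2

mono : ℕ → ℤ → ℕ → ℤ
mono N ε e = if e ≡ᵇ N then ε else ℤ.0ℤ

-- Coefficient of q^N in Ψ(-q^r, q^s).
-- Term n ≥ 0 : (-q^r)^{n(n+1)/2} (q^s)^{n(n-1)/2}
--            = (-1)^{n(n+1)/2} q^{r·n(n+1)/2 + s·n(n-1)/2}.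
-- Term n = -m, m ≥ 1 (subtracted): n(n+1)/2 = m(m-1)/2, n(n-1)/2 = m(m+1)/2, giving
--            (-1)^{m(m-1)/2} q^{r·m(m-1)/2 + s·m(m+1)/2}.
-- Exponents are ≥ n², so n, m ≤ N suffice.
psiCoeff : ℕ → ℕ → ℕ → ℤ
psiCoeff r s N =
  sumℤ (map (λ n → mono N (sgn (tri n)) (r ℕ.* tri n ℕ.+ s ℕ.* tri (n ℕ.∸ 1))) (upTo (suc N)))
  ℤ.- sumℤ (map (λ m → mono N (sgn (tri (m ℕ.∸ 1))) (r ℕ.* tri (m ℕ.∸ 1) ℕ.+ s ℕ.* tri m))
                (map suc (upTo N)))

-- revCoeffs r s N = [c(N), c(N-1), …, c(0)] for 1/Ψ(-q^r,q^s), via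
-- c(0) = 1, c(N) = - Σ_{j=1}^{N} a(j) c(N-j)  (a = psiCoeff r s, a(0) = 1).
revCoeffs : ℕ → ℕ → ℕ → List ℤ
revCoeffs r s zero = ℤ.1ℤ ∷ []
revCoeffs r s (suc N) =
  (- sumℤ (zipWith ℤ._*_ (map (λ j → psiCoeff r s (suc j)) (upTo (suc N))) prev)) ∷ prev
  where prev = revCoeffs r s N

headOr0 : List ℤ → ℤ
headOr0 [] = ℤ.0ℤ
headOr0 (x ∷ _) = x

c : ℕ → ℕ → ℕ → ℤ
c r s N = headOr0 (revCoeffs r s N)

{-# OPTIONS --safe #-}
-- Modulo 2, Ψ(-q¹¹, q³) ≡ ϑ₄ where ϑₐ = Σ_{m ∈ ℤ} q^(7m² + am), so the parities of c₁₁,₃ are the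
-- coefficients of 1/ϑ₄ over 𝔽₂. Since f² = f(q²) over 𝔽₂, the 2-dissections
-- ϑ₄ = ϑ₂(q²) + q³ϑ₅(q⁴) and ϑ₂ = ϑ₁(q⁴) + q⁵ϑ₆(q⁸), together with ϑ₆ϑ₄ = (ϑ₅ϑ₁)(q²) + q(ϑ₂ϑ₆)(q²),
-- can be pushed through 1/ϑ₄ three times, giving Σ_M c₁₁,₃(8M + 18) q^M ≡ ϑ₅ϑ₆ (mod 2).
-- The coefficient of q^M in ϑ₅ϑ₆ counts the (a, b) with 28M + 61 = (14a + 5)² + (14b + 6)². For the
-- indices of the theorem, 28M + 61 = p^(2k+1)(28n + 61p) with p ≡ 3 (mod 4) and p ∤ 28n + 61p,
-- and such a number is not a sum of two squares.
module Submission where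

module PowerSeries where

  open import Data.Bool using (Bool; true; false; _xor_; _∧_)
  open import Data.Bool.Properties
    using (∧-assoc; ∧-comm; ∧-idem; ∧-zeroʳ; ∧-distribʳ-xor; xor-identityʳ; xor-same)
  open import Data.Bool.Solver using (module xor-∧-Solver)
  open import Data.Nat using (ℕ; zero; suc; _+_; _≤_; z≤n; s≤s)
  open import Data.Nat.Properties using (≤-refl; +-suc; m≤n⇒m≤1+n; m≤n⇒m<n∨m≡n)
  open import Data.Sum using (inj₁; inj₂)
  open import Function using (_∘_)
  open import Relation.Binary.PropositionalEquality

  open xor-∧-Solver using (solve; _:+_; _:*_; _:=_)

  -- Power series over 𝔽₂: xor is addition and ∧ is multiplication.
  Series : Set
  Series = ℕ → Bool

  infixl 7 _·_
  infixl 6 _⊕_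

  0# : Series
  0# _ = false

  1# : Series
  1# zero    = true
  1# (suc _) = false

  _⊕_ : Series → Series → Series
  (f ⊕ g) n = f n xor g n

  tail : Series → Series
  tail f n = f (suc n)

  _·_ : Series → Series → Series
  (f · g) zero    = f 0 ∧ g 0
  (f · g) (suc n) = (f 0 ∧ g (suc n)) xor (tail f · g) n

  shift : Series → Series
  shift f zero    = false
  shift f (suc n) = f n

  -- dilate f = f(q²)
  dilate : Series → Series
  dilate f zero          = f 0
  dilate f (suc zero)    = false
  dilate f (suc (suc n)) = dilate (tail f) n

  double : ℕ → ℕ
  double zero    = zero
  double (suc n) = suc (suc (double n))

  evenPart : Series → Series
  evenPart f n = f (double n)

  oddPart : Series → Series
  oddPart f n = f (suc (double n))

  double≡+ : ∀ m → double m ≡ m + m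
  double≡+ zero    = refl
  double≡+ (suc m) = cong suc (trans (cong suc (double≡+ m)) (sym (+-suc m m)))

  private
    variable
      f f′ g g′ h : Series

  ⊕-cong : f ≗ f′ → g ≗ g′ → f ⊕ g ≗ f′ ⊕ g′
  ⊕-cong ef eg n = cong₂ _xor_ (ef n) (eg n)

  ⊕-congˡ : g ≗ g′ → f ⊕ g ≗ f ⊕ g′
  ⊕-congˡ {f = f} eg n = cong (f n xor_) (eg n)

  ·-cong : f ≗ f′ → g ≗ g′ → f · g ≗ f′ · g′
  ·-cong ef eg zero    = cong₂ _∧_ (ef 0) (eg 0)
  ·-cong ef eg (suc n) = cong₂ _xor_ (cong₂ _∧_ (ef 0) (eg (suc n))) (·-cong (ef ∘ suc) eg n)

  ·-congʳ : f ≗ f′ → f · g ≗ f′ · g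
  ·-congʳ ef = ·-cong ef (λ _ → refl)

  ·-congˡ : g ≗ g′ → f · g ≗ f · g′
  ·-congˡ = ·-cong (λ _ → refl)

  shift-cong : f ≗ g → shift f ≗ shift g
  shift-cong e zero    = refl
  shift-cong e (suc n) = e n

  dilate-cong : f ≗ g → dilate f ≗ dilate g
  dilate-cong e zero          = e 0
  dilate-cong e (suc zero)    = refl
  dilate-cong e (suc (suc n)) = dilate-cong (e ∘ suc) n

  evenPart-cong : f ≗ g → evenPart f ≗ evenPart g
  evenPart-cong e = e ∘ double

  oddPart-cong : f ≗ g → oddPart f ≗ oddPart g
  oddPart-cong e = e ∘ suc ∘ double

  ·-zeroˡ : ∀ f → 0# · f ≗ 0#
  ·-zeroˡ f zero    = refl
  ·-zeroˡ f (suc n) = ·-zeroˡ f n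

  ·-identityˡ : ∀ f → 1# · f ≗ f
  ·-identityˡ f zero    = refl
  ·-identityˡ f (suc n) = trans (cong (f (suc n) xor_) (·-zeroˡ f n)) (xor-identityʳ _)

  ·-distribʳ-⊕ : ∀ f g h → (f ⊕ g) · h ≗ f · h ⊕ g · h
  ·-distribʳ-⊕ f g h zero    = ∧-distribʳ-xor (h 0) (f 0) (g 0)
  ·-distribʳ-⊕ f g h (suc n) =
    trans (cong (((f 0 xor g 0) ∧ h (suc n)) xor_) (·-distribʳ-⊕ (tail f) (tail g) h n))
          (shuffle (f 0) (g 0) (h (suc n)) _ _)
    where
    shuffle : ∀ a b c x y → ((a xor b) ∧ c) xor (x xor y) ≡ ((a ∧ c) xor x) xor ((b ∧ c) xor y)
    shuffle = solve 5 (λ a b c x y → ((a :+ b) :* c) :+ (x :+ y) := ((a :* c) :+ x) :+ ((b :* c) :+ y)) refl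

  ·-comm : ∀ f g → f · g ≗ g · f
  ·-comm f g zero          = ∧-comm (f 0) (g 0)
  ·-comm f g (suc zero)    = swap (f 0) (g 1) (f 1) (g 0)
    where
    swap : ∀ a b c d → (a ∧ b) xor (c ∧ d) ≡ (d ∧ c) xor (b ∧ a)
    swap = solve 4 (λ a b c d → (a :* b) :+ (c :* d) := (d :* c) :+ (b :* a)) refl
  ·-comm f g (suc (suc n)) = begin
    (f 0 ∧ g (2 + n)) xor (tail f · g) (suc n)
      ≡⟨ cong ((f 0 ∧ g (2 + n)) xor_) (·-comm (tail f) g (suc n)) ⟩
    (f 0 ∧ g (2 + n)) xor ((g 0 ∧ f (2 + n)) xor (tail g · tail f) n)
      ≡⟨ cong (λ z → (f 0 ∧ g (2 + n)) xor ((g 0 ∧ f (2 + n)) xor z)) (·-comm (tail g) (tail f) n) ⟩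
    (f 0 ∧ g (2 + n)) xor ((g 0 ∧ f (2 + n)) xor (tail f · tail g) n)
      ≡⟨ exchange (f 0 ∧ g (2 + n)) (g 0 ∧ f (2 + n)) _ ⟩
    (g 0 ∧ f (2 + n)) xor ((f 0 ∧ g (2 + n)) xor (tail f · tail g) n)
      ≡⟨ cong ((g 0 ∧ f (2 + n)) xor_) (·-comm (tail g) f (suc n)) ⟨
    (g 0 ∧ f (2 + n)) xor (tail g · f) (suc n) ∎
    where
    open ≡-Reasoning
    exchange : ∀ a b x → a xor (b xor x) ≡ b xor (a xor x)
    exchange = solve 3 (λ a b x → a :+ (b :+ x) := b :+ (a :+ x)) refl

  ·-distribˡ-⊕ : ∀ f g h → f · (g ⊕ h) ≗ f · g ⊕ f · h
  ·-distribˡ-⊕ f g h n = begin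
    (f · (g ⊕ h)) n      ≡⟨ ·-comm f (g ⊕ h) n ⟩
    ((g ⊕ h) · f) n      ≡⟨ ·-distribʳ-⊕ g h f n ⟩
    (g · f ⊕ h · f) n    ≡⟨ cong₂ _xor_ (·-comm g f n) (·-comm h f n) ⟩
    (f · g ⊕ f · h) n    ∎
    where open ≡-Reasoning

  private
    scale : Bool → Series → Series
    scale b f n = b ∧ f n

    ·-scaleˡ : ∀ b f g → scale b f · g ≗ scale b (f · g)
    ·-scaleˡ b f g zero    = ∧-assoc b (f 0) (g 0)
    ·-scaleˡ b f g (suc n) =
      trans (cong (((b ∧ f 0) ∧ g (suc n)) xor_) (·-scaleˡ b (tail f) g n)) (factor b (f 0) (g (suc n)) _)
      where
      factor : ∀ b x y z → ((b ∧ x) ∧ y) xor (b ∧ z) ≡ b ∧ ((x ∧ y) xor z)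
      factor = solve 4 (λ b x y z → ((b :* x) :* y) :+ (b :* z) := b :* ((x :* y) :+ z)) refl

  -- tail (f · g) is definitionally scale (f 0) (tail g) ⊕ tail f · g.
  ·-assoc : ∀ f g h → (f · g) · h ≗ f · (g · h)
  ·-assoc f g h zero    = ∧-assoc (f 0) (g 0) (h 0)
  ·-assoc f g h (suc n) = begin
    ((f 0 ∧ g 0) ∧ h (suc n)) xor (tail (f · g) · h) n
      ≡⟨ cong (((f 0 ∧ g 0) ∧ h (suc n)) xor_) (·-distribʳ-⊕ (scale (f 0) (tail g)) (tail f · g) h n) ⟩
    ((f 0 ∧ g 0) ∧ h (suc n)) xor ((scale (f 0) (tail g) · h) n xor ((tail f · g) · h) n)
      ≡⟨ cong₂ (λ a b → ((f 0 ∧ g 0) ∧ h (suc n)) xor (a xor b)) (·-scaleˡ (f 0) (tail g) h n) (·-assoc (tail f) g h n) ⟩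
    ((f 0 ∧ g 0) ∧ h (suc n)) xor ((f 0 ∧ (tail g · h) n) xor (tail f · (g · h)) n)
      ≡⟨ factor (f 0) (g 0) (h (suc n)) _ _ ⟩
    (f 0 ∧ (g · h) (suc n)) xor (tail f · (g · h)) n ∎
    where
    open ≡-Reasoning
    factor : ∀ a b c x y → ((a ∧ b) ∧ c) xor ((a ∧ x) xor y) ≡ (a ∧ ((b ∧ c) xor x)) xor y
    factor = solve 5 (λ a b c x y → ((a :* b) :* c) :+ ((a :* x) :+ y) := (a :* ((b :* c) :+ x)) :+ y) refl

  shift-·ˡ : ∀ f g → shift f · g ≗ shift (f · g)
  shift-·ˡ f g zero    = refl
  shift-·ˡ f g (suc n) = refl

  shift-·ʳ : ∀ f g → f · shift g ≗ shift (f · g)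
  shift-·ʳ f g n = begin
    (f · shift g) n    ≡⟨ ·-comm f (shift g) n ⟩
    (shift g · f) n    ≡⟨ shift-·ˡ g f n ⟩
    shift (g · f) n    ≡⟨ shift-cong (·-comm g f) n ⟩
    shift (f · g) n    ∎
    where open ≡-Reasoning

  shift-⊕ : ∀ f g → shift (f ⊕ g) ≗ shift f ⊕ shift g
  shift-⊕ f g zero    = refl
  shift-⊕ f g (suc n) = refl

  frobenius : ∀ f → f · f ≗ dilate f
  frobenius f zero          = ∧-idem (f 0)
  frobenius f (suc zero)    = trans (cong ((f 0 ∧ f 1) xor_) (∧-comm (f 1) (f 0))) (xor-same (f 0 ∧ f 1))
  frobenius f (suc (suc n)) = begin
    (f 0 ∧ f (2 + n)) xor (tail f · f) (suc n)
      ≡⟨ cong ((f 0 ∧ f (2 + n)) xor_) (·-comm (tail f) f (suc n)) ⟩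
    (f 0 ∧ f (2 + n)) xor ((f 0 ∧ f (2 + n)) xor (tail f · tail f) n)
      ≡⟨ cancel (f 0 ∧ f (2 + n)) _ ⟩
    (tail f · tail f) n
      ≡⟨ frobenius (tail f) n ⟩
    dilate (tail f) n ∎
    where
    open ≡-Reasoning
    cancel : ∀ x y → x xor (x xor y) ≡ y
    cancel = solve 2 (λ x y → x :+ (x :+ y) := y) refl

  evenPart-dilate : ∀ f → evenPart (dilate f) ≗ f
  evenPart-dilate f zero    = refl
  evenPart-dilate f (suc n) = evenPart-dilate (tail f) n

  oddPart-dilate : ∀ f → oddPart (dilate f) ≗ 0#
  oddPart-dilate f zero    = refl
  oddPart-dilate f (suc n) = oddPart-dilate (tail f) n

  evenPart-shift : ∀ f → evenPart (shift f) ≗ shift (oddPart f)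
  evenPart-shift f zero    = refl
  evenPart-shift f (suc n) = refl

  dilate-shift : ∀ f → dilate (shift f) ≗ shift (shift (dilate f))
  dilate-shift f zero          = refl
  dilate-shift f (suc zero)    = refl
  dilate-shift f (suc (suc n)) = refl

  dilate-0# : dilate 0# ≗ 0#
  dilate-0# zero          = refl
  dilate-0# (suc zero)    = refl
  dilate-0# (suc (suc n)) = dilate-0# n

  dissection : ∀ f → f ≗ dilate (evenPart f) ⊕ shift (dilate (oddPart f))
  dissection f zero          = sym (xor-identityʳ _)
  dissection f (suc zero)    = refl
  dissection f (suc (suc n)) = trans (dissection (tail (tail f)) n) (cong (dilate (evenPart (tail (tail f))) n xor_) (odd n))
    where
    odd : ∀ n → shift (dilate (oddPart (tail (tail f)))) n ≡ shift (dilate (oddPart f)) (2 + n)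
    odd zero    = refl
    odd (suc n) = refl

  evenPart-·-dilate : ∀ f g → evenPart (f · dilate g) ≗ evenPart f · g
  evenPart-·-dilate f g zero    = refl
  evenPart-·-dilate f g (suc n) = begin
    (f 0 ∧ dilate (tail g) (double n)) xor ((f 1 ∧ dilate g (suc (double n))) xor (tail (tail f) · dilate g) (double n))
      ≡⟨ cong₂ (λ a b → (f 0 ∧ a) xor ((f 1 ∧ b) xor (tail (tail f) · dilate g) (double n)))
               (evenPart-dilate (tail g) n) (oddPart-dilate g n) ⟩
    (f 0 ∧ g (suc n)) xor ((f 1 ∧ false) xor (tail (tail f) · dilate g) (double n))
      ≡⟨ cong (λ a → (f 0 ∧ g (suc n)) xor (a xor (tail (tail f) · dilate g) (double n))) (∧-zeroʳ (f 1)) ⟩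
    (f 0 ∧ g (suc n)) xor (tail (tail f) · dilate g) (double n)
      ≡⟨ cong ((f 0 ∧ g (suc n)) xor_) (evenPart-·-dilate (tail (tail f)) g n) ⟩
    (f 0 ∧ g (suc n)) xor (evenPart (tail (tail f)) · g) n ∎
    where open ≡-Reasoning

  oddPart-·-dilate : ∀ f g → oddPart (f · dilate g) ≗ oddPart f · g
  oddPart-·-dilate f g n = begin
    (f 0 ∧ dilate g (suc (double n))) xor (tail f · dilate g) (double n)
      ≡⟨ cong (λ a → (f 0 ∧ a) xor (tail f · dilate g) (double n)) (oddPart-dilate g n) ⟩
    (f 0 ∧ false) xor (tail f · dilate g) (double n)
      ≡⟨ cong (_xor (tail f · dilate g) (double n)) (∧-zeroʳ (f 0)) ⟩
    (tail f · dilate g) (double n)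
      ≡⟨ evenPart-·-dilate (tail f) g n ⟩
    (evenPart (tail f) · g) n ∎
    where open ≡-Reasoning

  dilate-· : ∀ f g → dilate f · dilate g ≗ dilate (f · g)
  dilate-· f g n = begin
    (dilate f · dilate g) n
      ≡⟨ dissection (dilate f · dilate g) n ⟩
    dilate (evenPart (dilate f · dilate g)) n xor shift (dilate (oddPart (dilate f · dilate g))) n
      ≡⟨ cong₂ _xor_ (dilate-cong evens n) (shift-cong (dilate-cong odds) n) ⟩
    dilate (f · g) n xor shift (dilate 0#) n
      ≡⟨ cong (dilate (f · g) n xor_) (trans (shift-cong dilate-0# n) (shift-0# n)) ⟩
    dilate (f · g) n xor false
      ≡⟨ xor-identityʳ _ ⟩
    dilate (f · g) n ∎
    where
    open ≡-Reasoning
    evens : evenPart (dilate f · dilate g) ≗ f · g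
    evens m = trans (evenPart-·-dilate (dilate f) g m) (·-congʳ (evenPart-dilate f) m)
    odds : oddPart (dilate f · dilate g) ≗ 0#
    odds m = trans (oddPart-·-dilate (dilate f) g m) (trans (·-congʳ (oddPart-dilate f) m) (·-zeroˡ g m))
    shift-0# : shift 0# ≗ 0#
    shift-0# zero    = refl
    shift-0# (suc n) = refl

  private
    ·-vanishing : ∀ {d} n → (∀ k → k ≤ n → d k ≡ false) → ∀ h → (h · d) n ≡ false
    ·-vanishing zero    d≡0 h = trans (cong (h 0 ∧_) (d≡0 0 z≤n)) (∧-zeroʳ _)
    ·-vanishing (suc n) d≡0 h =
      trans (cong₂ (λ a b → (h 0 ∧ a) xor b) (d≡0 (suc n) ≤-refl) (·-vanishing n (λ k k≤n → d≡0 k (m≤n⇒m≤1+n k≤n)) (tail h)))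
            (cong (_xor false) (∧-zeroʳ (h 0)))

    unit-annihilates : ∀ {t d} → t 0 ≡ true → t · d ≗ 0# → ∀ n k → k ≤ n → d k ≡ false
    unit-annihilates t₀ td≡0 zero    .zero z≤n = trans (cong (_∧ _) (sym t₀)) (td≡0 0)
    unit-annihilates t₀ td≡0 (suc n) zero z≤n  = unit-annihilates t₀ td≡0 n zero z≤n
    unit-annihilates {t} {d} t₀ td≡0 (suc n) (suc k) (s≤s k≤n) with m≤n⇒m<n∨m≡n k≤n
    ... | inj₁ k<n  = unit-annihilates t₀ td≡0 n (suc k) k<n
    ... | inj₂ refl = begin
      d (suc n)                          ≡⟨ xor-identityʳ _ ⟨
      d (suc n) xor false                ≡⟨ cong₂ _xor_ (cong (_∧ d (suc n)) t₀)
                                                        (·-vanishing n (unit-annihilates t₀ td≡0 n) (tail t)) ⟨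
      (t 0 ∧ d (suc n)) xor (tail t · d) n ≡⟨ td≡0 (suc n) ⟩
      false                              ∎
      where open ≡-Reasoning

  ·-cancelʳ : ∀ {t} f g → t 0 ≡ true → f · t ≗ g · t → f ≗ g
  ·-cancelʳ {t} f g t₀ e n = xor≡false (unit-annihilates t₀ t·[f⊕g]≡0 n n ≤-refl)
    where
    xor≡false : ∀ {x y} → x xor y ≡ false → x ≡ y
    xor≡false {false} e = sym e
    xor≡false {true} {true} e = refl
    t·[f⊕g]≡0 : t · (f ⊕ g) ≗ 0#
    t·[f⊕g]≡0 k = begin
      (t · (f ⊕ g)) k          ≡⟨ ·-distribˡ-⊕ t f g k ⟩
      (t · f) k xor (t · g) k  ≡⟨ cong₂ _xor_ (·-comm t f k) (trans (·-comm t g k) (sym (e k))) ⟩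
      (f · t) k xor (f · t) k  ≡⟨ xor-same ((f · t) k) ⟩
      false                    ∎
      where open ≡-Reasoning

  ≗-by-dissection : evenPart f ≗ evenPart g → oddPart f ≗ oddPart g → f ≗ g
  ≗-by-dissection {f} {g} evens odds n = begin
    f n                                                            ≡⟨ dissection f n ⟩
    dilate (evenPart f) n xor shift (dilate (oddPart f)) n         ≡⟨ cong₂ _xor_ (dilate-cong evens n) (shift-cong (dilate-cong odds) n) ⟩
    dilate (evenPart g) n xor shift (dilate (oddPart g)) n         ≡⟨ dissection g n ⟨
    g n                                                            ∎
    where open ≡-Reasoning

  oddPart-· : ∀ f g → oddPart (f · g) ≗ oddPart f · evenPart g ⊕ evenPart f · oddPart g
  oddPart-· f g n = begin
    oddPart (f · g) n
      ≡⟨ oddPart-cong (·-congˡ {f = f} (dissection g)) n ⟩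
    oddPart (f · (dilate (evenPart g) ⊕ shift (dilate (oddPart g)))) n
      ≡⟨ oddPart-cong (·-distribˡ-⊕ f _ _) n ⟩
    oddPart (f · dilate (evenPart g)) n xor oddPart (f · shift (dilate (oddPart g))) n
      ≡⟨ cong₂ _xor_ (oddPart-·-dilate f (evenPart g) n) (oddPart-cong (shift-·ʳ f _) n) ⟩
    (oddPart f · evenPart g) n xor evenPart (f · dilate (oddPart g)) n
      ≡⟨ cong ((oddPart f · evenPart g) n xor_) (evenPart-·-dilate f (oddPart g) n) ⟩
    (oddPart f · evenPart g) n xor (evenPart f · oddPart g) n ∎
    where open ≡-Reasoning

  private
    dissect-quotient : ∀ {F t G} → F · t ≗ G → F · dilate t ≗ G · t
    dissect-quotient {F} {t} {G} e n = begin
      (F · dilate t) n     ≡⟨ ·-congˡ (frobenius t) n ⟨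
      (F · (t · t)) n      ≡⟨ ·-assoc F t t n ⟨
      ((F · t) · t) n      ≡⟨ ·-congʳ e n ⟩
      (G · t) n            ∎
      where open ≡-Reasoning

  -- Multiplying by t turns the divisor t into dilate t, which commutes with both dissection parts.
  evenPart-quotient : ∀ {F t G} → F · t ≗ G → evenPart F · t ≗ evenPart (G · t)
  evenPart-quotient {F} {t} e n = trans (sym (evenPart-·-dilate F t n)) (evenPart-cong (dissect-quotient e) n)

  oddPart-quotient : ∀ {F t G} → F · t ≗ G → oddPart F · t ≗ oddPart (G · t)
  oddPart-quotient {F} {t} e n = trans (sym (oddPart-·-dilate F t n)) (oddPart-cong (dissect-quotient e) n)

module XorSums where

  open import Data.Bool using (Bool; true; false; _xor_; _∧_)
  open import Data.Bool.Properties using (xor-comm; xor-identityʳ; ∧-distribʳ-xor)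
  open import Data.Bool.Solver using (module xor-∧-Solver)
  open import Data.Integer as ℤ using (ℤ; +_; -[1+_]; _+_; _*_; -_; _-_; ∣_∣)
  import Data.Integer.Properties as ℤ
  open import Algebra.Properties.AbelianGroup ℤ.+-0-abelianGroup using () renaming (∙-cancelˡ to +-cancelˡ)
  open import Data.Integer.Tactic.RingSolver using (solve-∀)
  open import Data.Nat as ℕ using (ℕ; zero; suc; _<_; _≤_; z≤n; s≤s; _∸_)
  import Data.Nat.Properties as ℕ
  import Data.Nat.Tactic.RingSolver as ℕ-Ring
  open import Data.Product using (∃; _×_; _,_)
  open import Function using (_∘_)
  open import Relation.Binary.PropositionalEquality
  open import Relation.Nullary using (contradiction)

  open PowerSeries using (Series; _·_; tail; double; double≡+)

  open xor-∧-Solver using (solve; _:+_; _:=_)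

  xorSum : ℕ → (ℕ → Bool) → Bool
  xorSum zero    f = false
  xorSum (suc n) f = f 0 xor xorSum n (f ∘ suc)

  private
    variable
      f g : ℕ → Bool

  xorSum-cong : ∀ n → (∀ i → i < n → f i ≡ g i) → xorSum n f ≡ xorSum n g
  xorSum-cong zero    e = refl
  xorSum-cong (suc n) e = cong₂ _xor_ (e 0 (s≤s z≤n)) (xorSum-cong n (λ i i<n → e (suc i) (s≤s i<n)))

  xorSum-cong-≗ : ∀ n → f ≗ g → xorSum n f ≡ xorSum n g
  xorSum-cong-≗ n e = xorSum-cong n (λ i _ → e i)

  xorSum-vanishing : ∀ n → (∀ i → i < n → f i ≡ false) → xorSum n f ≡ false
  xorSum-vanishing zero    _   = refl
  xorSum-vanishing (suc n) f≡0 =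
    cong₂ _xor_ (f≡0 0 (s≤s z≤n)) (xorSum-vanishing n (λ i i<n → f≡0 (suc i) (s≤s i<n)))

  xorSum-single : ∀ n j → j < n → (∀ i → i < n → i ≢ j → f i ≡ false) → xorSum n f ≡ f j
  xorSum-single {f} (suc n) zero    _         others =
    trans (cong (f 0 xor_) (xorSum-vanishing n (λ i i<n → others (suc i) (s≤s i<n) λ ())))
          (xor-identityʳ (f 0))
  xorSum-single (suc n) (suc j) (s≤s j<n) others =
    cong₂ _xor_ (others 0 (s≤s z≤n) λ ()) (xorSum-single n j j<n (λ i i<n i≢j → others (suc i) (s≤s i<n) (i≢j ∘ ℕ.suc-injective)))

  xorSum-distrib-xor : ∀ n f g → xorSum n (λ i → f i xor g i) ≡ xorSum n f xor xorSum n g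
  xorSum-distrib-xor zero    f g = refl
  xorSum-distrib-xor (suc n) f g =
    trans (cong ((f 0 xor g 0) xor_) (xorSum-distrib-xor n (f ∘ suc) (g ∘ suc)))
          (interchange (f 0) (g 0) _ _)
    where
    interchange : ∀ a b c d → (a xor b) xor (c xor d) ≡ (a xor c) xor (b xor d)
    interchange = solve 4 (λ a b c d → (a :+ b) :+ (c :+ d) := (a :+ c) :+ (b :+ d)) refl

  ∧-distribʳ-xorSum : ∀ n b f → xorSum n f ∧ b ≡ xorSum n (λ i → f i ∧ b)
  ∧-distribʳ-xorSum zero    b f = refl
  ∧-distribʳ-xorSum (suc n) b f =
    trans (∧-distribʳ-xor b (f 0) _) (cong ((f 0 ∧ b) xor_) (∧-distribʳ-xorSum n b (f ∘ suc)))

  private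
    reassoc : ∀ a b c → a xor (b xor c) ≡ (a xor b) xor c
    reassoc = solve 3 (λ a b c → a :+ (b :+ c) := (a :+ b) :+ c) refl

  xorSum-+ : ∀ m n f → xorSum (m ℕ.+ n) f ≡ xorSum m f xor xorSum n (λ i → f (m ℕ.+ i))
  xorSum-+ zero    n f = refl
  xorSum-+ (suc m) n f = trans (cong (f 0 xor_) (xorSum-+ m n (f ∘ suc))) (reassoc (f 0) _ _)

  xorSum-reverse : ∀ n f → xorSum n (λ i → f (n ∸ suc i)) ≡ xorSum n f
  xorSum-reverse zero    f = refl
  xorSum-reverse (suc n) f = begin
    f n xor xorSum n (λ i → f (n ∸ suc i))   ≡⟨ cong (f n xor_) (xorSum-reverse n f) ⟩
    f n xor xorSum n f                       ≡⟨ xor-comm (f n) _ ⟩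
    xorSum n f xor f n                       ≡⟨ xorSum-last n f ⟨
    xorSum (suc n) f                         ∎
    where
    open ≡-Reasoning
    xorSum-last : ∀ n f → xorSum (suc n) f ≡ xorSum n f xor f n
    xorSum-last zero    f = xor-comm (f 0) false
    xorSum-last (suc n) f = trans (cong (f 0 xor_) (xorSum-last n (f ∘ suc))) (reassoc (f 0) _ _)

  xorSum-comm : ∀ m n (g : ℕ → ℕ → Bool) →
                xorSum m (λ i → xorSum n (g i)) ≡ xorSum n (λ j → xorSum m (λ i → g i j))
  xorSum-comm zero    n g = sym (xorSum-vanishing n (λ _ _ → refl))
  xorSum-comm (suc m) n g =
    trans (cong (xorSum n (g 0) xor_) (xorSum-comm m n (g ∘ suc)))
          (sym (xorSum-distrib-xor n (g 0) (λ j → xorSum m (λ i → g (suc i) j))))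

  xorSum-double : ∀ n f → xorSum (double n) f ≡ xorSum n (f ∘ double) xor xorSum n (f ∘ suc ∘ double)
  xorSum-double zero    f = refl
  xorSum-double (suc n) f =
    trans (cong (λ z → f 0 xor (f 1 xor z)) (xorSum-double n (f ∘ suc ∘ suc)))
          (interleave (f 0) (f 1) _ _)
    where
    interleave : ∀ a b c d → a xor (b xor (c xor d)) ≡ (a xor c) xor (b xor d)
    interleave = solve 4 (λ a b c d → a :+ (b :+ (c :+ d)) := (a :+ c) :+ (b :+ d)) refl

  xorSum≡true⇒∃ : ∀ n f → xorSum n f ≡ true → ∃ λ i → i < n × f i ≡ true
  xorSum≡true⇒∃ (suc n) f e with f 0 in f0
  ... | true  = 0 , s≤s z≤n , f0
  ... | false with xorSum≡true⇒∃ n (f ∘ suc) e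
  ...   | i , i<n , fi = suc i , s≤s i<n , fi

  rangeSum : ℤ → ℕ → (ℤ → Bool) → Bool
  rangeSum L n f = xorSum n (λ i → f (L + + i))

  SupportedOn : (ℤ → Bool) → ℤ → ℕ → Set
  SupportedOn f L n = ∀ x → f x ≡ true → ∃ λ i → i < n × x ≡ L + + i

  private
    +-offset : ∀ L k i → L + + (k ℕ.+ i) ≡ (L + + k) + + i
    +-offset L k i = trans (cong (λ z → L + z) (ℤ.pos-+ k i)) (sym (ℤ.+-assoc L (+ k) (+ i)))

    offset-injective : ∀ L k i j → L + + i ≡ (L + + k) + + j → i ≡ k ℕ.+ j
    offset-injective L k i j e = ℤ.+-injective (+-cancelˡ L (+ i) (+ (k ℕ.+ j)) (trans e (sym (+-offset L k j))))

  rangeSum-restrict : ∀ f L n L′ k r n′ → SupportedOn f L n → L ≡ L′ + + k → k ℕ.+ (n ℕ.+ r) ≡ n′ →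
                      rangeSum L′ n′ f ≡ rangeSum L n f
  rangeSum-restrict f _ n L′ k r _ supp refl refl = begin
    xorSum (k ℕ.+ (n ℕ.+ r)) (λ i → f (L′ + + i))
      ≡⟨ xorSum-+ k (n ℕ.+ r) _ ⟩
    xorSum k (λ i → f (L′ + + i)) xor xorSum (n ℕ.+ r) (λ i → f (L′ + + (k ℕ.+ i)))
      ≡⟨ cong₂ _xor_ (xorSum-vanishing k below) (xorSum-+ n r _) ⟩
    false xor (xorSum n (λ i → f (L′ + + (k ℕ.+ i))) xor xorSum r (λ i → f (L′ + + (k ℕ.+ (n ℕ.+ i)))))
      ≡⟨ cong₂ _xor_ (xorSum-cong-≗ n (λ i → cong f (+-offset L′ k i))) (xorSum-vanishing r above) ⟩
    xorSum n (λ i → f ((L′ + + k) + + i)) xor false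
      ≡⟨ xor-identityʳ _ ⟩
    rangeSum (L′ + + k) n f ∎
    where
    open ≡-Reasoning
    below : ∀ i → i < k → f (L′ + + i) ≡ false
    below i i<k with f (L′ + + i) in fi
    ... | false = refl
    ... | true with supp _ fi
    ...   | j , _ , e = contradiction (subst (k ℕ.≤_) (sym (offset-injective L′ k i j e)) (ℕ.m≤m+n k j)) (ℕ.<⇒≱ i<k)
    above : ∀ i → i < r → f (L′ + + (k ℕ.+ (n ℕ.+ i))) ≡ false
    above i _ with f (L′ + + (k ℕ.+ (n ℕ.+ i))) in fi
    ... | false = refl
    ... | true with supp _ fi
    ...   | j , j<n , e = contradiction (subst (n ℕ.≤_) (ℕ.+-cancelˡ-≡ k _ _ (offset-injective L′ k _ j e)) (ℕ.m≤m+n n i)) (ℕ.<⇒≱ j<n)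

  boxSum : ℕ → (ℤ → Bool) → Bool
  boxSum B = rangeSum (- + B) (suc (B ℕ.+ B))

  Supported : (ℤ → Bool) → ℕ → Set
  Supported f B = ∀ x → f x ≡ true → ∣ x ∣ ≤ B

  private
    variable
      φ ψ : ℤ → Bool

    nat-sub : ∀ {i m} → i ≤ m → + (m ∸ i) ≡ + m - + i
    nat-sub {i} {m} i≤m = trans (sym (ℤ.⊖-≥ i≤m)) (sym (ℤ.m-n≡m⊖n m i))

  Supported⇒SupportedOn : ∀ B → Supported φ B → SupportedOn φ (- + B) (suc (B ℕ.+ B))
  Supported⇒SupportedOn B supp x φx with x | supp x φx
  ... | + n      | n≤B = B ℕ.+ n , s≤s (ℕ.+-monoʳ-≤ B n≤B) ,
    sym (trans (cong (λ z → - + B + z) (ℤ.pos-+ B n)) (cancel (+ B) (+ n)))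
    where cancel : ∀ b n → - b + (b + n) ≡ n
          cancel = solve-∀
  ... | -[1+ n ] | n<B = B ∸ suc n , s≤s (ℕ.≤-trans (ℕ.m∸n≤m B (suc n)) (ℕ.m≤m+n B B)) ,
    sym (trans (cong (λ z → - + B + z) (nat-sub n<B)) (cancel (+ B) (+ suc n)))
    where cancel : ∀ b m → - b + (b - m) ≡ - m
          cancel = solve-∀

  boxSum-enlarge : ∀ {B B′} → Supported φ B → B ≤ B′ → boxSum B φ ≡ boxSum B′ φ
  boxSum-enlarge {φ} {B} supp B≤B′ with ℕ.m≤n⇒∃[o]m+o≡n B≤B′
  ... | d , refl = sym (rangeSum-restrict φ _ _ (- + (B ℕ.+ d)) d d _ (Supported⇒SupportedOn B supp) left length)
    where
    left : - + B ≡ - + (B ℕ.+ d) + + d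
    left = trans (cancel (+ B) (+ d)) (cong (λ z → - z + + d) (sym (ℤ.pos-+ B d)))
      where cancel : ∀ b d → - b ≡ - (b + d) + d
            cancel = solve-∀
    length : d ℕ.+ (suc (B ℕ.+ B) ℕ.+ d) ≡ suc ((B ℕ.+ d) ℕ.+ (B ℕ.+ d))
    length = trans (ℕ.+-suc d _) (cong suc (rearrange B d))
      where rearrange : ∀ B d → d ℕ.+ ((B ℕ.+ B) ℕ.+ d) ≡ (B ℕ.+ d) ℕ.+ (B ℕ.+ d)
            rearrange = ℕ-Ring.solve-∀

  boxSum-cong : ∀ B → φ ≗ ψ → boxSum B φ ≡ boxSum B ψ
  boxSum-cong B e = xorSum-cong-≗ (suc (B ℕ.+ B)) (λ i → e (- + B + + i))

  boxSum-vanishing : ∀ B → (∀ x → φ x ≡ false) → boxSum B φ ≡ false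
  boxSum-vanishing B φ≡0 = xorSum-vanishing (suc (B ℕ.+ B)) (λ i _ → φ≡0 (- + B + + i))

  boxSum≡true⇒∃ : ∀ B φ → boxSum B φ ≡ true → ∃ λ x → φ x ≡ true
  boxSum≡true⇒∃ B φ e with xorSum≡true⇒∃ (suc (B ℕ.+ B)) _ e
  ... | i , _ , φx = - + B + + i , φx

  ∧-distribʳ-boxSum : ∀ B b φ → boxSum B φ ∧ b ≡ boxSum B (λ x → φ x ∧ b)
  ∧-distribʳ-boxSum B b φ = ∧-distribʳ-xorSum (suc (B ℕ.+ B)) b (λ i → φ (- + B + + i))

  boxSum-comm : ∀ B B′ (g : ℤ → ℤ → Bool) →
                boxSum B (λ x → boxSum B′ (g x)) ≡ boxSum B′ (λ y → boxSum B (λ x → g x y))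
  boxSum-comm B B′ g = xorSum-comm (suc (B ℕ.+ B)) (suc (B′ ℕ.+ B′)) (λ i j → g (- + B + + i) (- + B′ + + j))

  boxSum-neg : ∀ B φ → boxSum B (φ ∘ -_) ≡ boxSum B φ
  boxSum-neg B φ = trans (sym (xorSum-reverse (suc (B ℕ.+ B)) (λ i → φ (- (- + B + + i))))) (xorSum-cong (suc (B ℕ.+ B)) mirror)
    where
    reflect : ∀ b i → - (- b + ((b + b) - i)) ≡ - b + i
    reflect = solve-∀
    mirror : ∀ i → i < suc (B ℕ.+ B) → φ (- (- + B + + (B ℕ.+ B ∸ i))) ≡ φ (- + B + + i)
    mirror i (s≤s i≤2B) = cong φ (trans (cong (λ z → - (- + B + z)) (trans (nat-sub i≤2B) (cong (_- + i) (ℤ.pos-+ B B))))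
                                         (reflect (+ B) (+ i)))

  private
    rangeSum-hull : ∀ φ B s → SupportedOn φ (- + B + s) (suc (B ℕ.+ B)) →
                    rangeSum (- + B + s) (suc (B ℕ.+ B)) φ ≡ boxSum (B ℕ.+ ∣ s ∣) φ
    rangeSum-hull φ B (+ t) supp = sym (rangeSum-restrict φ _ _ (- + (B ℕ.+ t)) (t ℕ.+ t) 0 _ supp left length)
      where
      left : - + B + + t ≡ - + (B ℕ.+ t) + + (t ℕ.+ t)
      left = trans (move (+ B) (+ t)) (cong₂ (λ a b → - a + b) (sym (ℤ.pos-+ B t)) (sym (ℤ.pos-+ t t)))
        where move : ∀ b t → - b + t ≡ - (b + t) + (t + t)
              move = solve-∀
      length : (t ℕ.+ t) ℕ.+ (suc (B ℕ.+ B) ℕ.+ 0) ≡ suc ((B ℕ.+ t) ℕ.+ (B ℕ.+ t))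
      length = rearrange B t
        where rearrange : ∀ B t → (t ℕ.+ t) ℕ.+ (suc (B ℕ.+ B) ℕ.+ 0) ≡ suc ((B ℕ.+ t) ℕ.+ (B ℕ.+ t))
              rearrange = ℕ-Ring.solve-∀
    rangeSum-hull φ B -[1+ u ] supp = sym (rangeSum-restrict φ _ _ (- + (B ℕ.+ suc u)) 0 (suc u ℕ.+ suc u) _ supp left length)
      where
      left : - + B + -[1+ u ] ≡ - + (B ℕ.+ suc u) + + 0
      left = trans (move (+ B) (+ suc u)) (cong (λ a → - a + + 0) (sym (ℤ.pos-+ B (suc u))))
        where move : ∀ b t → - b + - t ≡ - (b + t) + + 0
              move = solve-∀
      length : 0 ℕ.+ (suc (B ℕ.+ B) ℕ.+ (suc u ℕ.+ suc u)) ≡ suc ((B ℕ.+ suc u) ℕ.+ (B ℕ.+ suc u))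
      length = rearrange B u
        where rearrange : ∀ B u → 0 ℕ.+ (suc (B ℕ.+ B) ℕ.+ (suc u ℕ.+ suc u)) ≡ suc ((B ℕ.+ suc u) ℕ.+ (B ℕ.+ suc u))
              rearrange = ℕ-Ring.solve-∀

  boxSum-shift : ∀ φ B s → Supported φ B → Supported (λ x → φ (x + s)) B → boxSum B (λ x → φ (x + s)) ≡ boxSum B φ
  boxSum-shift φ B s supp supp+s = begin
    boxSum B (λ x → φ (x + s))
      ≡⟨ xorSum-cong-≗ (suc (B ℕ.+ B)) (λ i → cong φ (swap (- + B) (+ i) s)) ⟩
    rangeSum (- + B + s) (suc (B ℕ.+ B)) φ
      ≡⟨ rangeSum-hull φ B s suppOn ⟩
    boxSum (B ℕ.+ ∣ s ∣) φ
      ≡⟨ boxSum-enlarge supp (ℕ.m≤m+n B _) ⟨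
    boxSum B φ ∎
    where
    open ≡-Reasoning
    swap : ∀ a b c → a + b + c ≡ a + c + b
    swap = solve-∀
    unshift : ∀ x s → x ≡ x - s + s
    unshift = solve-∀
    suppOn : SupportedOn φ (- + B + s) (suc (B ℕ.+ B))
    suppOn x φx with Supported⇒SupportedOn B supp+s (x - s) (subst (λ z → φ z ≡ true) (unshift x s) φx)
    ... | i , i<n , e = i , i<n , trans (unshift x s) (trans (cong (_+ s) e) (swap (- + B) (+ i) s))

  boxSum-parity : ∀ φ B → Supported φ B →
                  boxSum B φ ≡ boxSum B (λ j → φ (+ 2 * j)) xor boxSum B (λ j → φ (+ 2 * j + + 1))
  boxSum-parity φ B supp = begin
    boxSum B φ
      ≡⟨ rangeSum-restrict φ _ _ (- + (B ℕ.+ B)) B (suc B) (double n) (Supported⇒SupportedOn B supp) left length ⟨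
    xorSum (double n) h
      ≡⟨ xorSum-double n h ⟩
    xorSum n (h ∘ double) xor xorSum n (h ∘ suc ∘ double)
      ≡⟨ cong₂ _xor_ (xorSum-cong-≗ n evens) (xorSum-cong-≗ n odds) ⟩
    boxSum B (λ j → φ (+ 2 * j)) xor boxSum B (λ j → φ (+ 2 * j + + 1)) ∎
    where
    open ≡-Reasoning
    n = suc (B ℕ.+ B)
    h : ℕ → Bool
    h i = φ (- + (B ℕ.+ B) + + i)
    left : - + B ≡ - + (B ℕ.+ B) + + B
    left = trans (move (+ B)) (cong (λ z → - z + + B) (sym (ℤ.pos-+ B B)))
      where move : ∀ b → - b ≡ - (b + b) + b
            move = solve-∀
    length : B ℕ.+ (suc (B ℕ.+ B) ℕ.+ suc B) ≡ double n
    length = trans (rearrange B) (sym (double≡+ n))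
      where rearrange : ∀ B → B ℕ.+ (suc (B ℕ.+ B) ℕ.+ suc B) ≡ suc (B ℕ.+ B) ℕ.+ suc (B ℕ.+ B)
            rearrange = ℕ-Ring.solve-∀
    +double : ∀ i → + double i ≡ + i + + i
    +double i = trans (cong +_ (double≡+ i)) (ℤ.pos-+ i i)
    even-index : ∀ b i → - (b + b) + (i + i) ≡ + 2 * (- b + i)
    even-index = solve-∀
    odd-index : ∀ b i → - (b + b) + (+ 1 + (i + i)) ≡ + 2 * (- b + i) + + 1
    odd-index = solve-∀
    evens : ∀ i → h (double i) ≡ φ (+ 2 * (- + B + + i))
    evens i = cong φ (trans (cong₂ (λ a c → - a + c) (ℤ.pos-+ B B) (+double i)) (even-index (+ B) (+ i)))
    odds : ∀ i → h (suc (double i)) ≡ φ (+ 2 * (- + B + + i) + + 1)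
    odds i = cong φ (trans (cong₂ (λ a c → - a + c) (ℤ.pos-+ B B) (trans (ℤ.pos-+ 1 (double i)) (cong (λ z → + 1 + z) (+double i))))
                           (odd-index (+ B) (+ i)))

  ·-coefficient : ∀ (f g : Series) N → (f · g) N ≡ xorSum (suc N) (λ i → f i ∧ g (N ∸ i))
  ·-coefficient f g zero    = sym (xor-identityʳ _)
  ·-coefficient f g (suc N) = cong ((f 0 ∧ g (suc N)) xor_) (·-coefficient (tail f) g N)

  boxSum-reflect : ∀ φ {K M} → Supported φ K → K < M → boxSum M (λ j → φ (- j - + 1)) ≡ boxSum M φ
  boxSum-reflect φ {K} {M} supp K<M =
    trans (boxSum-neg M (λ y → φ (y - + 1))) (boxSum-shift φ M (- + 1) wider shifted)
    where
    wider : Supported φ M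
    wider x φx = ℕ.≤-trans (supp x φx) (ℕ.<⇒≤ K<M)
    restore : ∀ y → y - + 1 + + 1 ≡ y
    restore = solve-∀
    shifted : Supported (λ y → φ (y - + 1)) M
    shifted y φy = begin
      ∣ y ∣                    ≡⟨ cong ∣_∣ (restore y) ⟨
      ∣ y - + 1 + + 1 ∣        ≤⟨ ℤ.∣i+j∣≤∣i∣+∣j∣ (y - + 1) (+ 1) ⟩
      ∣ y - + 1 ∣ ℕ.+ 1        ≤⟨ ℕ.+-monoˡ-≤ 1 (supp _ φy) ⟩
      K ℕ.+ 1                  ≡⟨ ℕ.+-comm K 1 ⟩
      suc K                    ≤⟨ K<M ⟩
      M                        ∎
      where open ℕ.≤-Reasoning

  boxSum-halves : ∀ N φ → boxSum N φ ≡ xorSum N (λ k → φ -[1+ k ]) xor xorSum (suc N) (λ i → φ (+ i))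
  boxSum-halves N φ = begin
    xorSum (suc (N ℕ.+ N)) h
      ≡⟨ cong (λ n → xorSum n h) (sym (ℕ.+-suc N N)) ⟩
    xorSum (N ℕ.+ suc N) h
      ≡⟨ xorSum-+ N (suc N) h ⟩
    xorSum N h xor xorSum (suc N) (λ i → h (N ℕ.+ i))
      ≡⟨ cong₂ _xor_ (trans (sym (xorSum-reverse N h)) (xorSum-cong N negatives)) (xorSum-cong-≗ (suc N) nonNegatives) ⟩
    xorSum N (λ k → φ -[1+ k ]) xor xorSum (suc N) (λ i → φ (+ i)) ∎
    where
    open ≡-Reasoning
    h : ℕ → Bool
    h i = φ (- + N + + i)
    negatives : ∀ k → k < N → h (N ∸ suc k) ≡ φ -[1+ k ]
    negatives k k<N = cong φ (trans (cong (λ z → - + N + z) (nat-sub k<N)) (cancel (+ N) (+ suc k)))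
      where cancel : ∀ n m → - n + (n - m) ≡ - m
            cancel = solve-∀
    nonNegatives : ∀ i → h (N ℕ.+ i) ≡ φ (+ i)
    nonNegatives i = cong φ (trans (cong (λ z → - + N + z) (ℤ.pos-+ N i)) (cancel (+ N) (+ i)))
      where cancel : ∀ n i → - n + (n + i) ≡ i
            cancel = solve-∀

module Parity where

  open import Data.Bool using (Bool; true; false; _xor_; _∧_)
  open import Data.Integer using (ℤ; +_; -[1+_]; _+_; _*_; -_; _-_; ∣_∣)
  import Data.Integer.Divisibility as ℤD
  open import Data.Integer.Properties using (pos-+; abs-*)
  open import Data.Integer.Tactic.RingSolver using (solve-∀)
  open import Data.Nat as ℕ using (ℕ; zero; suc)
  import Data.Nat.Divisibility as ℕD
  import Data.Nat.Properties as ℕ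
  open import Data.Product using (∃; _,_)
  open import Data.Sum using (_⊎_; inj₁; inj₂)
  open import Relation.Nullary using (contradiction)
  open import Relation.Binary.PropositionalEquality

  private
    halve : ∀ n → ∃ λ q → n ≡ q ℕ.+ q ⊎ n ≡ suc (q ℕ.+ q)
    halve zero    = 0 , inj₁ refl
    halve (suc n) with halve n
    ... | q , inj₁ e = q , inj₂ (cong suc e)
    ... | q , inj₂ e = suc q , inj₁ (cong suc (trans e (sym (ℕ.+-suc q q))))

  even-or-odd : ∀ x → ∃ λ k → x ≡ + 2 * k ⊎ x ≡ + 2 * k + + 1
  even-or-odd (+ n) with halve n
  ... | q , inj₁ refl = + q , inj₁ (trans (pos-+ q q) (double (+ q)))
    where double : ∀ x → x + x ≡ + 2 * x
          double = solve-∀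
  ... | q , inj₂ refl = + q , inj₂ (trans (pos-+ 1 (q ℕ.+ q)) (trans (cong (λ z → + 1 + z) (pos-+ q q)) (double+1 (+ q))))
    where double+1 : ∀ x → + 1 + (x + x) ≡ + 2 * x + + 1
          double+1 = solve-∀
  even-or-odd -[1+ n ] with even-or-odd (+ n)
  ... | k , inj₁ e = - k - + 1 , inj₂ (trans (cong (λ x → - (+ 1 + x)) e) (negate-even k))
    where negate-even : ∀ k → - (+ 1 + + 2 * k) ≡ + 2 * (- k - + 1) + + 1
          negate-even = solve-∀
  ... | k , inj₂ e = - k - + 1 , inj₁ (trans (cong (λ x → - (+ 1 + x)) e) (negate-odd k))
    where negate-odd : ∀ k → - (+ 1 + (+ 2 * k + + 1)) ≡ + 2 * (- k - + 1)
          negate-odd = solve-∀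

  even≢odd : ∀ k l → + 2 * k ≢ + 2 * l + + 1
  even≢odd k l e = ℕ.even≢odd ∣ k - l ∣ 0 (trans (sym (abs-* (+ 2) (k - l))) (cong ∣_∣ 2[k-l]≡1))
    where
    difference : ∀ k l → + 2 * (k - l) ≡ (+ 2 * k) - (+ 2 * l)
    difference = solve-∀
    cancel : ∀ l → (+ 2 * l + + 1) - (+ 2 * l) ≡ + 1
    cancel = solve-∀
    2[k-l]≡1 : + 2 * (k - l) ≡ + 1
    2[k-l]≡1 = trans (difference k l) (trans (cong (_- (+ 2 * l)) e) (cancel l))

  parity : ℤ → Bool
  parity x with even-or-odd x
  ... | _ , inj₁ _ = false
  ... | _ , inj₂ _ = true

  parity-even : ∀ x k → x ≡ + 2 * k → parity x ≡ false
  parity-even x k e with even-or-odd x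
  ... | _ , inj₁ _  = refl
  ... | l , inj₂ e′ = contradiction (trans (sym e) e′) (even≢odd k l)

  parity-odd : ∀ x k → x ≡ + 2 * k + + 1 → parity x ≡ true
  parity-odd x k e with even-or-odd x
  ... | l , inj₁ e′ = contradiction (trans (sym e′) e) (even≢odd l k)
  ... | _ , inj₂ _  = refl

  parity-0 : parity (+ 0) ≡ false
  parity-0 = parity-even (+ 0) (+ 0) refl

  parity-+ : ∀ x y → parity (x + y) ≡ parity x xor parity y
  parity-+ x y with even-or-odd x | even-or-odd y
  ... | k , inj₁ refl | l , inj₁ refl = parity-even _ (k + l) (even+even k l)
    where even+even : ∀ k l → + 2 * k + + 2 * l ≡ + 2 * (k + l)
          even+even = solve-∀
  ... | k , inj₁ refl | l , inj₂ refl = parity-odd _ (k + l) (even+odd k l)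
    where even+odd : ∀ k l → + 2 * k + (+ 2 * l + + 1) ≡ + 2 * (k + l) + + 1
          even+odd = solve-∀
  ... | k , inj₂ refl | l , inj₁ refl = parity-odd _ (k + l) (odd+even k l)
    where odd+even : ∀ k l → (+ 2 * k + + 1) + + 2 * l ≡ + 2 * (k + l) + + 1
          odd+even = solve-∀
  ... | k , inj₂ refl | l , inj₂ refl = parity-even _ (k + l + + 1) (odd+odd k l)
    where odd+odd : ∀ k l → (+ 2 * k + + 1) + (+ 2 * l + + 1) ≡ + 2 * (k + l + + 1)
          odd+odd = solve-∀

  parity-* : ∀ x y → parity (x * y) ≡ parity x ∧ parity y
  parity-* x y with even-or-odd x | even-or-odd y
  ... | k , inj₁ refl | _ = parity-even _ (k * y) (even*any k y)
    where even*any : ∀ k y → (+ 2 * k) * y ≡ + 2 * (k * y)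
          even*any = solve-∀
  ... | k , inj₂ refl | l , inj₁ refl = parity-even _ ((+ 2 * k + + 1) * l) (odd*even k l)
    where odd*even : ∀ k l → (+ 2 * k + + 1) * (+ 2 * l) ≡ + 2 * ((+ 2 * k + + 1) * l)
          odd*even = solve-∀
  ... | k , inj₂ refl | l , inj₂ refl = parity-odd _ (+ 2 * k * l + k + l) (odd*odd k l)
    where odd*odd : ∀ k l → (+ 2 * k + + 1) * (+ 2 * l + + 1) ≡ + 2 * (+ 2 * k * l + k + l) + + 1
          odd*odd = solve-∀

  parity-neg : ∀ x → parity (- x) ≡ parity x
  parity-neg x with even-or-odd x
  ... | k , inj₁ refl = parity-even _ (- k) (neg-even k)
    where neg-even : ∀ k → - (+ 2 * k) ≡ + 2 * (- k)
          neg-even = solve-∀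
  ... | k , inj₂ refl = parity-odd _ (- k - + 1) (neg-odd k)
    where neg-odd : ∀ k → - (+ 2 * k + + 1) ≡ + 2 * (- k - + 1) + + 1
          neg-odd = solve-∀

  parity-- : ∀ x y → parity (x - y) ≡ parity x xor parity y
  parity-- x y = trans (parity-+ x (- y)) (cong (parity x xor_) (parity-neg y))

  parity≡false⇒2∣ : ∀ x → parity x ≡ false → + 2 ℤD.∣ x
  parity≡false⇒2∣ x p with even-or-odd x
  ... | k , inj₁ refl = ℕD.divides ∣ k ∣ (trans (abs-* (+ 2) k) (ℕ.*-comm 2 ∣ k ∣))
  ... | _ , inj₂ _    = contradiction p λ ()

module ThetaSeries where

  open import Data.Bool using (Bool; true; false; _xor_; _∧_)
  open import Data.Bool.Properties using (xor-identityʳ)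
  open import Data.Integer as ℤ using (ℤ; +_; _+_; _*_; -_; _-_; ∣_∣; +≤+)
  open import Data.Integer.Properties as ℤ using (_≟_)
  open import Data.Integer.Tactic.RingSolver using (solve-∀)
  open import Data.Nat as ℕ using (ℕ; zero; suc; _<_; _≤_; s≤s; _∸_)
  import Data.Nat.Properties as ℕ
  open import Data.Product using (∃; _×_; _,_; proj₁; proj₂)
  open import Function using (mk⇔)
  open import Relation.Binary.PropositionalEquality
  open import Relation.Nullary using (contradiction; does; yes; no)
  open import Relation.Nullary.Decidable using (dec-true; dec-false; does-⇔)

  open PowerSeries
  open XorSums
  open Parity using (even≢odd)

  infix 4 _==_
  _==_ : ℤ → ℤ → Bool
  x == y = does (x ≟ y)

  ==⇒≡ : ∀ {x y} → (x == y) ≡ true → x ≡ y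
  ==⇒≡ {x} {y} e with x ≟ y
  ... | yes x≡y = x≡y
  ... | no  _   = contradiction e λ ()

  ≢⇒==false : ∀ {x y} → x ≢ y → (x == y) ≡ false
  ≢⇒==false {x} {y} = dec-false (x ≟ y)

  ==-cong-⇔ : ∀ {x y x′ y′} → (x ≡ y → x′ ≡ y′) → (x′ ≡ y′ → x ≡ y) → (x == y) ≡ (x′ == y′)
  ==-cong-⇔ {x} {y} {x′} {y′} to from = does-⇔ (mk⇔ to from) (x ≟ y) (x′ ≟ y′)

  Coercive : (ℤ → ℤ) → Set
  Coercive Q = ∀ m → + ∣ m ∣ ℤ.≤ Q m

  private
    variable
      Q R : ℤ → ℤ

  coercive⇒nonNegative : Coercive Q → ∀ m → ∃ λ j → Q m ≡ + j
  coercive⇒nonNegative {Q} c m with Q m | c m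
  ... | + j | _ = j , refl

  coercive-double : Coercive Q → Coercive (λ m → + 2 * Q m)
  coercive-double {Q} c m with Q m | c m
  ... | + j | +≤+ m≤j = subst (+ ∣ m ∣ ℤ.≤_) (ℤ.pos-* 2 j) (+≤+ (ℕ.≤-trans m≤j (ℕ.m≤m+n j _)))

  coercive-suc : Coercive Q → Coercive (λ m → Q m + + 1)
  coercive-suc {Q} c m with Q m | c m
  ... | + j | +≤+ m≤j = +≤+ (ℕ.≤-trans m≤j (ℕ.m≤m+n j 1))

  level : (ℤ → ℤ) → ℕ → ℤ → Bool
  level Q N m = Q m == + N

  level-supported : Coercive Q → ∀ {N B} → N ≤ B → Supported (level Q N) B
  level-supported c N≤B m hit = ℕ.≤-trans (ℤ.drop‿+≤+ (ℤ.≤-trans (c m) (ℤ.≤-reflexive (==⇒≡ hit)))) N≤B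

  -- θ Q = Σ_{m ∈ ℤ} q^(Q m) over 𝔽₂; coercivity puts every m with Q m = N in [-N, N].
  θ : (ℤ → ℤ) → Series
  θ Q N = boxSum N (level Q N)

  θ-box : Coercive Q → ∀ {N B} → N ≤ B → θ Q N ≡ boxSum B (level Q N)
  θ-box c N≤B = boxSum-enlarge (level-supported c ℕ.≤-refl) N≤B

  level₂ : (ℤ → ℤ) → (ℤ → ℤ) → ℕ → ℤ → ℤ → Bool
  level₂ Q R N m n = Q m + R n == + N

  θ₂ : (ℤ → ℤ) → (ℤ → ℤ) → Series
  θ₂ Q R N = boxSum N (λ m → boxSum N (level₂ Q R N m))

  private
    -- In the Cauchy product, the row of m keeps only the term i = Q m.
    product-row : Coercive Q → Coercive R → ∀ N m →
                  xorSum (suc N) (λ i → level Q i m ∧ θ R (N ∸ i)) ≡ boxSum N (level₂ Q R N m)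
    product-row {Q} {R} cQ cR N m with coercive⇒nonNegative cQ m
    ... | j , Qm≡j with j ℕ.≤? N
    ...   | yes j≤N = begin
      xorSum (suc N) (λ i → level Q i m ∧ θ R (N ∸ i))   ≡⟨ xorSum-single (suc N) j (s≤s j≤N) others ⟩
      level Q j m ∧ θ R (N ∸ j)                          ≡⟨ cong (_∧ θ R (N ∸ j)) (dec-true (Q m ≟ + j) Qm≡j) ⟩
      θ R (N ∸ j)                                        ≡⟨ θ-box cR (ℕ.m∸n≤m N j) ⟩
      boxSum N (level R (N ∸ j))                         ≡⟨ boxSum-cong N (λ n → ==-cong-⇔ (to n) (from n)) ⟩
      boxSum N (level₂ Q R N m)                          ∎
      where
      open ≡-Reasoning
      others : ∀ i → i < suc N → i ≢ j → level Q i m ∧ θ R (N ∸ i) ≡ false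
      others i _ i≢j = cong (_∧ θ R (N ∸ i)) (≢⇒==false (λ Qm≡i → i≢j (ℤ.+-injective (trans (sym Qm≡i) Qm≡j))))
      N-j : + (N ∸ j) ≡ + N - + j
      N-j = trans (sym (ℤ.⊖-≥ j≤N)) (sym (ℤ.m-n≡m⊖n N j))
      complement : ∀ (j N : ℤ) → j + (N - j) ≡ N
      complement = solve-∀
      subtract : ∀ (j x : ℤ) → x ≡ (j + x) - j
      subtract = solve-∀
      to : ∀ n → R n ≡ + (N ∸ j) → Q m + R n ≡ + N
      to n e = trans (cong₂ _+_ Qm≡j (trans e N-j)) (complement (+ j) (+ N))
      from : ∀ n → Q m + R n ≡ + N → R n ≡ + (N ∸ j)
      from n e = trans (subtract (+ j) (R n)) (trans (cong (_- + j) (trans (cong (_+ R n) (sym Qm≡j)) e)) (sym N-j))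
    ...   | no j≰N = trans (xorSum-vanishing (suc N) too-small) (sym (boxSum-vanishing N too-large))
      where
      too-small : ∀ i → i < suc N → level Q i m ∧ θ R (N ∸ i) ≡ false
      too-small i (s≤s i≤N) =
        cong (_∧ θ R (N ∸ i)) (≢⇒==false (λ Qm≡i → j≰N (subst (_≤ N) (ℤ.+-injective (trans (sym Qm≡i) Qm≡j)) i≤N)))
      too-large : ∀ n → level₂ Q R N m n ≡ false
      too-large n with coercive⇒nonNegative cR n
      ... | r , Rn≡r = ≢⇒==false λ e → j≰N (ℕ.≤-trans (ℕ.m≤m+n j r)
                         (ℕ.≤-reflexive (ℤ.+-injective (trans (ℤ.pos-+ j r) (trans (cong₂ _+_ (sym Qm≡j) (sym Rn≡r)) e)))))

  θ-· : Coercive Q → Coercive R → θ Q · θ R ≗ θ₂ Q R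
  θ-· {Q} {R} cQ cR N = begin
    (θ Q · θ R) N                                                 ≡⟨ ·-coefficient (θ Q) (θ R) N ⟩
    xorSum (suc N) (λ i → θ Q i ∧ θ R (N ∸ i))                    ≡⟨ xorSum-cong (suc N) expand ⟩
    xorSum (suc N) (λ i → boxSum N (λ m → level Q i m ∧ θ R (N ∸ i)))
      ≡⟨ xorSum-comm (suc N) (suc (N ℕ.+ N)) (λ i k → level Q i (- + N + + k) ∧ θ R (N ∸ i)) ⟩
    boxSum N (λ m → xorSum (suc N) (λ i → level Q i m ∧ θ R (N ∸ i))) ≡⟨ boxSum-cong N (product-row cQ cR N) ⟩
    θ₂ Q R N                                                      ∎
    where
    open ≡-Reasoning
    expand : ∀ i → i < suc N → θ Q i ∧ θ R (N ∸ i) ≡ boxSum N (λ m → level Q i m ∧ θ R (N ∸ i))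
    expand i (s≤s i≤N) = trans (cong (_∧ θ R (N ∸ i)) (θ-box cQ i≤N)) (∧-distribʳ-boxSum N (θ R (N ∸ i)) (level Q i))

  private
    +double : ∀ n → + double n ≡ + 2 * + n
    +double n = trans (cong +_ (double≡+ n)) (trans (ℤ.pos-+ n n) (twice (+ n)))
      where twice : ∀ x → x + x ≡ + 2 * x
            twice = solve-∀

    +suc-double : ∀ n → + suc (double n) ≡ + 2 * + n + + 1
    +suc-double n = trans (ℤ.pos-+ 1 (double n)) (trans (cong (λ z → + 1 + z) (+double n)) (ℤ.+-comm (+ 1) (+ 2 * + n)))

    2*-injective : ∀ {x y} → + 2 * x ≡ + 2 * y → x ≡ y
    2*-injective {x} {y} = ℤ.*-cancelˡ-≡ (+ 2) x y

    +1-injective : ∀ {x y} → x + + 1 ≡ y + + 1 → x ≡ y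
    +1-injective {x} {y} e = trans (undo x) (trans (cong (_- + 1) e) (sym (undo y)))
      where undo : ∀ x → x ≡ x + + 1 - + 1
            undo = solve-∀

    even==odd : ∀ {x y} → (∃ λ k → x ≡ + 2 * k) → (∃ λ t → y ≡ + 2 * t + + 1) → (x == y) ≡ false
    even==odd (k , refl) (t , refl) = ≢⇒==false (even≢odd k t)

    odd==even : ∀ {x y} → (∃ λ t → x ≡ + 2 * t + + 1) → (∃ λ k → y ≡ + 2 * k) → (x == y) ≡ false
    odd==even (t , refl) (k , refl) = ≢⇒==false (λ e → even≢odd k t (sym e))

    n≤double : ∀ n → n ≤ double n
    n≤double n = subst (n ≤_) (sym (double≡+ n)) (ℕ.m≤m+n n n)

  dilate-θ : Coercive Q → dilate (θ Q) ≗ θ (λ m → + 2 * Q m)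
  dilate-θ {Q} c = ≗-by-dissection evens odds
    where
    evens : evenPart (dilate (θ Q)) ≗ evenPart (θ (λ m → + 2 * Q m))
    evens n = trans (evenPart-dilate (θ Q) n) (trans (θ-box c (n≤double n)) (boxSum-cong (double n) halve))
      where
      halve : ∀ m → level Q n m ≡ (+ 2 * Q m == + double n)
      halve m = ==-cong-⇔ {Q m} {+ n} (λ e → trans (cong (+ 2 *_) e) (sym (+double n))) (λ e → 2*-injective (trans e (+double n)))
    odds : oddPart (dilate (θ Q)) ≗ oddPart (θ (λ m → + 2 * Q m))
    odds n = trans (oddPart-dilate (θ Q) n) (sym (boxSum-vanishing (suc (double n)) (λ m → even==odd (Q m , refl) (+ n , +suc-double n))))

  shift-θ : Coercive Q → shift (θ Q) ≗ θ (λ m → Q m + + 1)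
  shift-θ {Q} c zero    = sym (boxSum-vanishing 0 positive)
    where
    positive : ∀ m → (Q m + + 1 == + 0) ≡ false
    positive m with coercive⇒nonNegative c m
    ... | j , Qm≡j = ≢⇒==false (λ e → ℕ.1+n≢0 (ℤ.+-injective (trans (trans (cong +_ (ℕ.+-comm 1 j)) (ℤ.pos-+ j 1))
                                                                (trans (cong (_+ + 1) (sym Qm≡j)) e))))
  shift-θ {Q} c (suc K) = trans (θ-box c (ℕ.n≤1+n K)) (boxSum-cong (suc K) raise)
    where
    +suc : + suc K ≡ + K + + 1
    +suc = trans (ℤ.pos-+ 1 K) (ℤ.+-comm (+ 1) (+ K))
    raise : ∀ m → level Q K m ≡ (Q m + + 1 == + suc K)
    raise m = ==-cong-⇔ {Q m} {+ K} (λ e → trans (cong (_+ + 1) e) (sym +suc)) (λ e → +1-injective (trans e +suc))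

  evenPart-θ : Coercive Q → Coercive R →
               (∀ j → Q (+ 2 * j) ≡ + 2 * R j) → (∀ j → ∃ λ t → Q (+ 2 * j + + 1) ≡ + 2 * t + + 1) →
               evenPart (θ Q) ≗ θ R
  evenPart-θ {Q} {R} cQ cR evens odds N = begin
    boxSum M (level Q M)
      ≡⟨ boxSum-parity (level Q M) M (level-supported cQ ℕ.≤-refl) ⟩
    boxSum M (λ j → level Q M (+ 2 * j)) xor boxSum M (λ j → level Q M (+ 2 * j + + 1))
      ≡⟨ cong₂ _xor_ (boxSum-cong M halve) (boxSum-vanishing M (λ j → odd==even (odds j) (+ N , +double N))) ⟩
    boxSum M (level R N) xor false
      ≡⟨ xor-identityʳ _ ⟩
    boxSum M (level R N)
      ≡⟨ θ-box cR (n≤double N) ⟨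
    θ R N ∎
    where
    open ≡-Reasoning
    M : ℕ
    M = double N
    halve : ∀ j → level Q M (+ 2 * j) ≡ level R N j
    halve j = ==-cong-⇔ {Q (+ 2 * j)} {+ M} {R j} {+ N}
      (λ e → 2*-injective (trans (sym (evens j)) (trans e (+double N))))
      (λ e → trans (evens j) (trans (cong (+ 2 *_) e) (sym (+double N))))

  oddPart-θ : Coercive Q → Coercive R →
              (∀ j → ∃ λ t → Q (+ 2 * j) ≡ + 2 * t) → (∀ j → Q (+ 2 * j + + 1) ≡ + 2 * R (- j - + 1) + + 1) →
              oddPart (θ Q) ≗ θ R
  oddPart-θ {Q} {R} cQ cR evens odds N = begin
    boxSum M (level Q M)
      ≡⟨ boxSum-parity (level Q M) M (level-supported cQ ℕ.≤-refl) ⟩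
    boxSum M (λ j → level Q M (+ 2 * j)) xor boxSum M (λ j → level Q M (+ 2 * j + + 1))
      ≡⟨ cong₂ _xor_ (boxSum-vanishing M (λ j → even==odd (evens j) (+ N , +suc-double N))) (boxSum-cong M halve) ⟩
    false xor boxSum M (λ j → level R N (- j - + 1))
      ≡⟨ boxSum-reflect (level R N) (level-supported cR ℕ.≤-refl) (s≤s (n≤double N)) ⟩
    boxSum M (level R N)
      ≡⟨ θ-box cR (ℕ.m≤n⇒m≤1+n (n≤double N)) ⟨
    θ R N ∎
    where
    open ≡-Reasoning
    M : ℕ
    M = suc (double N)
    halve : ∀ j → level Q M (+ 2 * j + + 1) ≡ level R N (- j - + 1)
    halve j = ==-cong-⇔ {Q (+ 2 * j + + 1)} {+ M} {R (- j - + 1)} {+ N}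
      (λ e → 2*-injective (+1-injective (trans (sym (odds j)) (trans e (+suc-double N)))))
      (λ e → trans (odds j) (trans (cong (λ z → + 2 * z + + 1) e) (sym (+suc-double N))))

  level₂-bound : Coercive Q → Coercive R → ∀ {N} m n → level₂ Q R N m n ≡ true → ∣ m ∣ ≤ N × ∣ n ∣ ≤ N
  level₂-bound cQ cR {N} m n hit with coercive⇒nonNegative cQ m | coercive⇒nonNegative cR n
  ... | j , Qm≡j | r , Rn≡r = bound {m} (cQ m) Qm≡j (ℕ.m≤m+n j r) , bound {n} (cR n) Rn≡r (ℕ.m≤n+m r j)
    where
    j+r≡N : j ℕ.+ r ≡ N
    j+r≡N = ℤ.+-injective (trans (ℤ.pos-+ j r) (trans (cong₂ _+_ (sym Qm≡j) (sym Rn≡r)) (==⇒≡ hit)))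
    bound : ∀ {x y k} → + ∣ x ∣ ℤ.≤ y → y ≡ + k → k ≤ j ℕ.+ r → ∣ x ∣ ≤ N
    bound {x} x≤y refl k≤ = ℕ.≤-trans (ℤ.drop‿+≤+ x≤y) (subst (_ ≤_) j+r≡N k≤)

  rows-supported : Coercive Q → Coercive R → ∀ N B → Supported (λ m → boxSum B (level₂ Q R N m)) N
  rows-supported cQ cR N B m hit with boxSum≡true⇒∃ B _ hit
  ... | n , hit′ = proj₁ (level₂-bound cQ cR m n hit′)

  module _ {Q R : ℤ → ℤ} (cQ : Coercive Q) (cR : Coercive R) where

    diagonal : ℕ → ℤ → Bool
    diagonal N s = boxSum N (λ m → level₂ Q R N m (s - m))

    private
      triangle : ∀ {N} s m → ∣ s - m ∣ ≤ N → ∣ m ∣ ≤ N → ∣ s ∣ ≤ suc (N ℕ.+ N)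
      triangle {N} s m s-m≤N m≤N = begin
        ∣ s ∣                  ≡⟨ cong ∣_∣ (restore s m) ⟨
        ∣ s - m + m ∣          ≤⟨ ℤ.∣i+j∣≤∣i∣+∣j∣ (s - m) m ⟩
        ∣ s - m ∣ ℕ.+ ∣ m ∣    ≤⟨ ℕ.+-mono-≤ s-m≤N m≤N ⟩
        N ℕ.+ N                <⟨ ℕ.n<1+n _ ⟩
        suc (N ℕ.+ N)          ∎
        where
        open ℕ.≤-Reasoning
        restore : ∀ s m → s - m + m ≡ s
        restore = solve-∀

    diagonal-supported : ∀ N → Supported (diagonal N) (suc (N ℕ.+ N))
    diagonal-supported N s hit with boxSum≡true⇒∃ N _ hit
    ... | m , hit′ with level₂-bound cQ cR m (s - m) hit′
    ...   | m≤N , s-m≤N = triangle s m s-m≤N m≤N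

    θ₂-diagonals : ∀ N → θ₂ Q R N ≡ boxSum (suc (N ℕ.+ N)) (diagonal N)
    θ₂-diagonals N = begin
      boxSum N (λ m → boxSum N (level₂ Q R N m))
        ≡⟨ boxSum-cong N (λ m → boxSum-enlarge (column m) N≤M) ⟩
      boxSum N (λ m → boxSum M (level₂ Q R N m))
        ≡⟨ boxSum-cong N (λ m → boxSum-shift (level₂ Q R N m) M (- m) (wide m) (sheared m)) ⟨
      boxSum N (λ m → boxSum M (λ s → level₂ Q R N m (s - m)))
        ≡⟨ boxSum-comm N M (λ m s → level₂ Q R N m (s - m)) ⟩
      boxSum M (diagonal N) ∎
      where
      open ≡-Reasoning
      M : ℕ
      M = suc (N ℕ.+ N)
      N≤M : N ≤ M
      N≤M = ℕ.m≤n⇒m≤1+n (ℕ.m≤m+n N N)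
      column : ∀ m → Supported (level₂ Q R N m) N
      column m n hit = proj₂ (level₂-bound cQ cR m n hit)
      wide : ∀ m → Supported (level₂ Q R N m) M
      wide m n hit = ℕ.≤-trans (column m n hit) N≤M
      sheared : ∀ m → Supported (λ s → level₂ Q R N m (s - m)) M
      sheared m s hit with level₂-bound cQ cR m (s - m) hit
      ... | m≤N , s-m≤N = triangle s m s-m≤N m≤N

    θ₂-parity : ∀ N → θ₂ Q R N ≡ boxSum (suc (N ℕ.+ N)) (λ a → diagonal N (+ 2 * a))
                              xor boxSum (suc (N ℕ.+ N)) (λ a → diagonal N (+ 2 * a + + 1))
    θ₂-parity N = trans (θ₂-diagonals N) (boxSum-parity (diagonal N) _ (diagonal-supported N))

    module _ {Q′ R′ : ℤ → ℤ} (cQ′ : Coercive Q′) (cR′ : Coercive R′) where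

      private
        N<M : ∀ N → N < suc (N ℕ.+ N)
        N<M N = s≤s (ℕ.m≤m+n N N)

        level₂-cong : ∀ {N m n m′ n′} → Q m + R n ≡ Q′ m′ + R′ n′ → level₂ Q R N m n ≡ level₂ Q′ R′ N m′ n′
        level₂-cong {N} e = cong (_== + N) e

      even-diagonals : (∀ a b → Q (a + b) + R (a - b) ≡ Q′ a + R′ b) →
                       ∀ N → boxSum (suc (N ℕ.+ N)) (λ a → diagonal N (+ 2 * a)) ≡ θ₂ Q′ R′ N
      even-diagonals recentre N = trans (boxSum-cong M row) (sym (boxSum-enlarge (rows-supported cQ′ cR′ N N) (ℕ.<⇒≤ (N<M N))))
        where
        M : ℕ
        M = suc (N ℕ.+ N)
        row : ∀ a → diagonal N (+ 2 * a) ≡ boxSum N (level₂ Q′ R′ N a)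
        row a = trans (sym (boxSum-shift φ N a φ-supported shifted-supported)) (boxSum-cong N shear)
          where
          φ : ℤ → Bool
          φ m = level₂ Q R N m (+ 2 * a - m)
          coordinates : ∀ a b → (b + a ≡ a + b) × (+ 2 * a - (b + a) ≡ a - b)
          coordinates a b = ℤ.+-comm b a , difference a b
            where difference : ∀ a b → + 2 * a - (b + a) ≡ a - b
                  difference = solve-∀
          shear : ∀ b → φ (b + a) ≡ level₂ Q′ R′ N a b
          shear b = level₂-cong (trans (cong₂ (λ u v → Q u + R v) (proj₁ (coordinates a b)) (proj₂ (coordinates a b))) (recentre a b))
          φ-supported : Supported φ N
          φ-supported m hit = proj₁ (level₂-bound cQ cR m _ hit)
          shifted-supported : Supported (λ b → φ (b + a)) N
          shifted-supported b hit = proj₂ (level₂-bound cQ′ cR′ a b (trans (sym (shear b)) hit))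

      odd-diagonals : (∀ a b → Q (a - b) + R (a + b + + 1) ≡ Q′ (- a - + 1) + R′ b) →
                      ∀ N → boxSum (suc (N ℕ.+ N)) (λ a → diagonal N (+ 2 * a + + 1)) ≡ θ₂ Q′ R′ N
      odd-diagonals recentre N = begin
        boxSum M (λ a → diagonal N (+ 2 * a + + 1))
          ≡⟨ boxSum-cong M row ⟩
        boxSum M (λ a → boxSum N (level₂ Q′ R′ N (- a - + 1)))
          ≡⟨ boxSum-reflect (λ x → boxSum N (level₂ Q′ R′ N x)) (rows-supported cQ′ cR′ N N) (N<M N) ⟩
        boxSum M (λ x → boxSum N (level₂ Q′ R′ N x))
          ≡⟨ boxSum-enlarge (rows-supported cQ′ cR′ N N) (ℕ.<⇒≤ (N<M N)) ⟨
        θ₂ Q′ R′ N ∎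
        where
        open ≡-Reasoning
        M : ℕ
        M = suc (N ℕ.+ N)
        row : ∀ a → diagonal N (+ 2 * a + + 1) ≡ boxSum N (level₂ Q′ R′ N (- a - + 1))
        row a = begin
          boxSum N φ                       ≡⟨ boxSum-shift φ N a φ-supported shifted-supported ⟨
          boxSum N (λ y → φ (y + a))       ≡⟨ boxSum-neg N (λ y → φ (y + a)) ⟨
          boxSum N (λ y → φ (- y + a))     ≡⟨ boxSum-cong N shear ⟩
          boxSum N (level₂ Q′ R′ N (- a - + 1)) ∎
          where
          φ : ℤ → Bool
          φ m = level₂ Q R N m (+ 2 * a + + 1 - m)
          coordinates : ∀ a b → (- b + a ≡ a - b) × (+ 2 * a + + 1 - (- b + a) ≡ a + b + + 1)
          coordinates a b = ℤ.+-comm (- b) a , difference a b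
            where difference : ∀ a b → + 2 * a + + 1 - (- b + a) ≡ a + b + + 1
                  difference = solve-∀
          shear : ∀ b → φ (- b + a) ≡ level₂ Q′ R′ N (- a - + 1) b
          shear b = level₂-cong (trans (cong₂ (λ u v → Q u + R v) (proj₁ (coordinates a b)) (proj₂ (coordinates a b))) (recentre a b))
          φ-supported : Supported φ N
          φ-supported m hit = proj₁ (level₂-bound cQ cR m _ hit)
          shifted-supported : Supported (λ y → φ (y + a)) N
          shifted-supported y hit = subst (_≤ N) (ℤ.∣-i∣≡∣i∣ y) (proj₂ (level₂-bound cQ′ cR′ (- a - + 1) (- y) reflected))
            where
            reflected : level₂ Q′ R′ N (- a - + 1) (- y) ≡ true
            reflected = trans (sym (shear (- y))) (subst (λ z → φ (z + a) ≡ true) (sym (ℤ.neg-involutive y)) hit)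

  θ₂-split : ∀ {Q R Q′ R′ Q″ R″} → Coercive Q → Coercive R → Coercive Q′ → Coercive R′ → Coercive Q″ → Coercive R″ →
             (∀ a b → Q (a + b) + R (a - b) ≡ Q′ a + R′ b) →
             (∀ a b → Q (a - b) + R (a + b + + 1) ≡ Q″ (- a - + 1) + R″ b) →
             θ₂ Q R ≗ θ₂ Q′ R′ ⊕ θ₂ Q″ R″
  θ₂-split cQ cR cQ′ cR′ cQ″ cR″ evens odds N =
    trans (θ₂-parity cQ cR N) (cong₂ _xor_ (even-diagonals cQ cR cQ′ cR′ evens N) (odd-diagonals cQ cR cQ″ cR″ odds N))

module ThetaIdentities where

  open import Data.Integer as ℤ using (ℤ; +_; -[1+_]; _+_; _*_; -_; _-_; +≤+)
  import Data.Integer.Properties as ℤ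
  open import Data.Integer.Tactic.RingSolver using (solve-∀)
  open import Data.Nat as ℕ using (ℕ; suc; _≤_; z≤n)
  import Data.Nat.Properties as ℕ
  open import Data.Bool using (Bool; false)
  open import Data.Product using (∃; _,_)
  open import Relation.Binary.PropositionalEquality
  import Relation.Binary.Reasoning.Setoid (ℕ →-setoid Bool) as ≗-Reasoning

  open PowerSeries
  open XorSums using (boxSum-vanishing)
  open ThetaSeries

  Q₇ : ℕ → ℤ → ℤ
  Q₇ a m = + 7 * m * m + + a * m

  ϑ : ℕ → Series
  ϑ a = θ (Q₇ a)

  Q₇-nonNegative : ∀ a n → Q₇ a (+ n) ≡ + (7 ℕ.* n ℕ.* n ℕ.+ a ℕ.* n)
  Q₇-nonNegative a n = sym (trans (ℤ.pos-+ (7 ℕ.* n ℕ.* n) (a ℕ.* n))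
    (cong₂ _+_ (trans (ℤ.pos-* (7 ℕ.* n) n) (cong (_* + n) (ℤ.pos-* 7 n))) (ℤ.pos-* a n)))

  -- 7(n+1)² - a(n+1) = (n+1)(7n + 7 - a), and 7 - a = c + 1.
  Q₇-negative : ∀ a c n → a ℕ.+ c ≡ 6 → Q₇ a -[1+ n ] ≡ + (suc n ℕ.* (7 ℕ.* n ℕ.+ suc c))
  Q₇-negative a c n a+c≡6 = begin
    + 7 * x * x + + a * x                              ≡⟨ cong (λ s → s * x * x + + a * x) seven ⟩
    (+ a + + c + + 1) * x * x + + a * x                ≡⟨ factor (+ a) (+ c) (+ n) ⟩
    + suc n * ((+ a + + c + + 1) * + n + + suc c)      ≡⟨ cong (λ s → + suc n * (s * + n + + suc c)) seven ⟨
    + suc n * (+ 7 * + n + + suc c)                    ≡⟨ cong (λ s → + suc n * (s + + suc c)) (ℤ.pos-* 7 n) ⟨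
    + suc n * + (7 ℕ.* n ℕ.+ suc c)                    ≡⟨ ℤ.pos-* (suc n) _ ⟨
    + (suc n ℕ.* (7 ℕ.* n ℕ.+ suc c))                  ∎
    where
    open ≡-Reasoning
    x : ℤ
    x = -[1+ n ]
    seven : + 7 ≡ + a + + c + + 1
    seven = trans (cong +_ (cong (ℕ._+ 1) (sym a+c≡6))) (trans (ℤ.pos-+ (a ℕ.+ c) 1) (cong (_+ + 1) (ℤ.pos-+ a c)))
    factor : ∀ A C X → (A + C + + 1) * (- (+ 1 + X)) * (- (+ 1 + X)) + A * (- (+ 1 + X))
                     ≡ (+ 1 + X) * ((A + C + + 1) * X + (+ 1 + C))
    factor = solve-∀

  Q₇-coercive : ∀ {a} → a ≤ 6 → Coercive (Q₇ a)
  Q₇-coercive {a} _ (+ n) = subst (+ n ℤ.≤_) (sym (Q₇-nonNegative a n)) (+≤+ (ℕ.≤-trans (n≤7nn n) (ℕ.m≤m+n _ _)))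
    where
    n≤7nn : ∀ n → n ≤ 7 ℕ.* n ℕ.* n
    n≤7nn ℕ.zero    = z≤n
    n≤7nn n@(suc _) = ℕ.≤-trans (ℕ.m≤n*m n 7) (ℕ.m≤m*n (7 ℕ.* n) n)
  Q₇-coercive {a} a≤6 -[1+ n ] with ℕ.m≤n⇒∃[o]m+o≡n a≤6
  ... | c , a+c≡6 = subst (+ suc n ℤ.≤_) (sym (Q₇-negative a c n a+c≡6))
                          (+≤+ (ℕ.m≤m*n (suc n) (7 ℕ.* n ℕ.+ suc c) {{ℕ.>-nonZero (ℕ.≤-trans (ℕ.s≤s z≤n) (ℕ.m≤n+m (suc c) (7 ℕ.* n)))}}))

  private
    c₁ : Coercive (Q₇ 1)
    c₁ = Q₇-coercive (ℕ.m≤m+n 1 5)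
    c₂ : Coercive (Q₇ 2)
    c₂ = Q₇-coercive (ℕ.m≤m+n 2 4)
    c₄ : Coercive (Q₇ 4)
    c₄ = Q₇-coercive (ℕ.m≤m+n 4 2)
    c₅ : Coercive (Q₇ 5)
    c₅ = Q₇-coercive (ℕ.m≤m+n 5 1)
    c₆ : Coercive (Q₇ 6)
    c₆ = Q₇-coercive (ℕ.≤-refl {6})

  evenPart-ϑ₄ : evenPart (ϑ 4) ≗ dilate (ϑ 2)
  evenPart-ϑ₄ n = trans (evenPart-θ c₄ (coercive-double c₂) evens odds n) (sym (dilate-θ c₂ n))
    where
    evens : ∀ j → Q₇ 4 (+ 2 * j) ≡ + 2 * (+ 2 * Q₇ 2 j)
    evens = expand
      where expand : ∀ j → + 7 * (+ 2 * j) * (+ 2 * j) + + 4 * (+ 2 * j) ≡ + 2 * (+ 2 * (+ 7 * j * j + + 2 * j))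
            expand = solve-∀
    odds : ∀ j → ∃ λ t → Q₇ 4 (+ 2 * j + + 1) ≡ + 2 * t + + 1
    odds j = + 14 * j * j + + 18 * j + + 5 , expand j
      where expand : ∀ j → + 7 * (+ 2 * j + + 1) * (+ 2 * j + + 1) + + 4 * (+ 2 * j + + 1) ≡ + 2 * (+ 14 * j * j + + 18 * j + + 5) + + 1
            expand = solve-∀

  oddPart-ϑ₄ : oddPart (ϑ 4) ≗ shift (dilate (ϑ 5))
  oddPart-ϑ₄ = begin
    oddPart (ϑ 4)                          ≈⟨ oddPart-θ c₄ (coercive-suc (coercive-double c₅)) evens odds ⟩
    θ (λ m → + 2 * Q₇ 5 m + + 1)           ≈⟨ shift-θ (coercive-double c₅) ⟨
    shift (θ (λ m → + 2 * Q₇ 5 m))         ≈⟨ shift-cong (dilate-θ c₅) ⟨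
    shift (dilate (ϑ 5))                   ∎
    where
    open ≗-Reasoning
    evens : ∀ j → ∃ λ t → Q₇ 4 (+ 2 * j) ≡ + 2 * t
    evens j = + 14 * j * j + + 4 * j , expand j
      where expand : ∀ j → + 7 * (+ 2 * j) * (+ 2 * j) + + 4 * (+ 2 * j) ≡ + 2 * (+ 14 * j * j + + 4 * j)
            expand = solve-∀
    odds : ∀ j → Q₇ 4 (+ 2 * j + + 1) ≡ + 2 * (+ 2 * Q₇ 5 (- j - + 1) + + 1) + + 1
    odds = expand
      where expand : ∀ j → + 7 * (+ 2 * j + + 1) * (+ 2 * j + + 1) + + 4 * (+ 2 * j + + 1)
                         ≡ + 2 * (+ 2 * (+ 7 * (- j - + 1) * (- j - + 1) + + 5 * (- j - + 1)) + + 1) + + 1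
            expand = solve-∀

  evenPart-ϑ₂ : evenPart (ϑ 2) ≗ dilate (ϑ 1)
  evenPart-ϑ₂ n = trans (evenPart-θ c₂ (coercive-double c₁) evens odds n) (sym (dilate-θ c₁ n))
    where
    evens : ∀ j → Q₇ 2 (+ 2 * j) ≡ + 2 * (+ 2 * Q₇ 1 j)
    evens = expand
      where expand : ∀ j → + 7 * (+ 2 * j) * (+ 2 * j) + + 2 * (+ 2 * j) ≡ + 2 * (+ 2 * (+ 7 * j * j + + 1 * j))
            expand = solve-∀
    odds : ∀ j → ∃ λ t → Q₇ 2 (+ 2 * j + + 1) ≡ + 2 * t + + 1
    odds j = + 14 * j * j + + 16 * j + + 4 , expand j
      where expand : ∀ j → + 7 * (+ 2 * j + + 1) * (+ 2 * j + + 1) + + 2 * (+ 2 * j + + 1) ≡ + 2 * (+ 14 * j * j + + 16 * j + + 4) + + 1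
            expand = solve-∀

  oddPart-ϑ₂ : oddPart (ϑ 2) ≗ dilate (shift (ϑ 6))
  oddPart-ϑ₂ = begin
    oddPart (ϑ 2)                          ≈⟨ oddPart-θ c₂ (coercive-double (coercive-suc c₆)) evens odds ⟩
    θ (λ m → + 2 * (Q₇ 6 m + + 1))         ≈⟨ dilate-θ (coercive-suc c₆) ⟨
    dilate (θ (λ m → Q₇ 6 m + + 1))        ≈⟨ dilate-cong (shift-θ c₆) ⟨
    dilate (shift (ϑ 6))                   ∎
    where
    open ≗-Reasoning
    evens : ∀ j → ∃ λ t → Q₇ 2 (+ 2 * j) ≡ + 2 * t
    evens j = + 14 * j * j + + 2 * j , expand j
      where expand : ∀ j → + 7 * (+ 2 * j) * (+ 2 * j) + + 2 * (+ 2 * j) ≡ + 2 * (+ 14 * j * j + + 2 * j)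
            expand = solve-∀
    odds : ∀ j → Q₇ 2 (+ 2 * j + + 1) ≡ + 2 * (+ 2 * (Q₇ 6 (- j - + 1) + + 1)) + + 1
    odds = expand
      where expand : ∀ j → + 7 * (+ 2 * j + + 1) * (+ 2 * j + + 1) + + 2 * (+ 2 * j + + 1)
                         ≡ + 2 * (+ 2 * ((+ 7 * (- j - + 1) * (- j - + 1) + + 6 * (- j - + 1)) + + 1)) + + 1
            expand = solve-∀

  private
    2Q₁ 2Q₂ 2Q₂+1 2Q₅ 2Q₆ : ℤ → ℤ
    2Q₁ m   = + 2 * Q₇ 1 m
    2Q₂ m   = + 2 * Q₇ 2 m
    2Q₂+1 m = + 2 * Q₇ 2 m + + 1
    2Q₅ m   = + 2 * Q₇ 5 m
    2Q₆ m   = + 2 * Q₇ 6 m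

    c2Q₁ : Coercive 2Q₁
    c2Q₁ = coercive-double c₁
    c2Q₂ : Coercive 2Q₂
    c2Q₂ = coercive-double c₂
    c2Q₂+1 : Coercive 2Q₂+1
    c2Q₂+1 = coercive-suc c2Q₂
    c2Q₅ : Coercive 2Q₅
    c2Q₅ = coercive-double c₅
    c2Q₆ : Coercive 2Q₆
    c2Q₆ = coercive-double c₆

    θ₂-2Q₅-2Q₁ : θ₂ 2Q₅ 2Q₁ ≗ dilate (ϑ 5 · ϑ 1)
    θ₂-2Q₅-2Q₁ = begin
      θ₂ 2Q₅ 2Q₁                   ≈⟨ θ-· c2Q₅ c2Q₁ ⟨
      θ 2Q₅ · θ 2Q₁                ≈⟨ ·-cong (dilate-θ c₅) (dilate-θ c₁) ⟨
      dilate (ϑ 5) · dilate (ϑ 1)  ≈⟨ dilate-· (ϑ 5) (ϑ 1) ⟩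
      dilate (ϑ 5 · ϑ 1)           ∎
      where open ≗-Reasoning

    θ₂-2Q₂+1-2Q₆ : θ₂ 2Q₂+1 2Q₆ ≗ shift (dilate (ϑ 2 · ϑ 6))
    θ₂-2Q₂+1-2Q₆ = begin
      θ₂ 2Q₂+1 2Q₆                          ≈⟨ θ-· c2Q₂+1 c2Q₆ ⟨
      θ 2Q₂+1 · θ 2Q₆                       ≈⟨ ·-congʳ (shift-θ c2Q₂) ⟨
      shift (θ 2Q₂) · θ 2Q₆                 ≈⟨ ·-cong (shift-cong (dilate-θ c₂)) (dilate-θ c₆) ⟨
      shift (dilate (ϑ 2)) · dilate (ϑ 6)   ≈⟨ shift-·ˡ (dilate (ϑ 2)) (dilate (ϑ 6)) ⟩
      shift (dilate (ϑ 2) · dilate (ϑ 6))   ≈⟨ shift-cong (dilate-· (ϑ 2) (ϑ 6)) ⟩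
      shift (dilate (ϑ 2 · ϑ 6))            ∎
      where open ≗-Reasoning

  ϑ-product : ϑ 6 · ϑ 4 ≗ dilate (ϑ 5 · ϑ 1) ⊕ shift (dilate (ϑ 2 · ϑ 6))
  ϑ-product = begin
    ϑ 6 · ϑ 4                                          ≈⟨ θ-· c₆ c₄ ⟩
    θ₂ (Q₇ 6) (Q₇ 4)                                   ≈⟨ θ₂-split c₆ c₄ c2Q₅ c2Q₁ c2Q₂+1 c2Q₆ evens odds ⟩
    θ₂ 2Q₅ 2Q₁ ⊕ θ₂ 2Q₂+1 2Q₆                           ≈⟨ ⊕-cong θ₂-2Q₅-2Q₁ θ₂-2Q₂+1-2Q₆ ⟩
    dilate (ϑ 5 · ϑ 1) ⊕ shift (dilate (ϑ 2 · ϑ 6))    ∎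
    where
    open ≗-Reasoning
    evens : ∀ a b → Q₇ 6 (a + b) + Q₇ 4 (a - b) ≡ 2Q₅ a + 2Q₁ b
    evens = expand
      where expand : ∀ a b → (+ 7 * (a + b) * (a + b) + + 6 * (a + b)) + (+ 7 * (a - b) * (a - b) + + 4 * (a - b))
                           ≡ + 2 * (+ 7 * a * a + + 5 * a) + + 2 * (+ 7 * b * b + + 1 * b)
            expand = solve-∀
    odds : ∀ a b → Q₇ 6 (a - b) + Q₇ 4 (a + b + + 1) ≡ 2Q₂+1 (- a - + 1) + 2Q₆ b
    odds = expand
      where expand : ∀ a b → (+ 7 * (a - b) * (a - b) + + 6 * (a - b)) + (+ 7 * (a + b + + 1) * (a + b + + 1) + + 4 * (a + b + + 1))
                           ≡ (+ 2 * (+ 7 * (- a - + 1) * (- a - + 1) + + 2 * (- a - + 1)) + + 1) + + 2 * (+ 7 * b * b + + 6 * b)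
            expand = solve-∀

  private
    +∣x∣² : ∀ x → + (ℤ.∣ x ∣ ℕ.* ℤ.∣ x ∣) ≡ x * x
    +∣x∣² (+ n)    = ℤ.pos-* n n
    +∣x∣² -[1+ n ] = refl

  -- 28(7a² + 5a + 7b² + 6b) + 61 = (14a + 5)² + (14b + 6)²
  ϑ₅·ϑ₆-vanishes : ∀ {M} → (∀ X Y → X ℕ.* X ℕ.+ Y ℕ.* Y ≢ 28 ℕ.* M ℕ.+ 61) → (ϑ 5 · ϑ 6) M ≡ false
  ϑ₅·ϑ₆-vanishes {M} no-representation =
    trans (θ-· c₅ c₆ M) (boxSum-vanishing M (λ a → boxSum-vanishing M (λ b → ≢⇒==false (no-solution a b))))
    where
    complete-squares : ∀ a b → (+ 14 * a + + 5) * (+ 14 * a + + 5) + (+ 14 * b + + 6) * (+ 14 * b + + 6)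
                             ≡ + 28 * ((+ 7 * a * a + + 5 * a) + (+ 7 * b * b + + 6 * b)) + + 61
    complete-squares = solve-∀
    no-solution : ∀ a b → Q₇ 5 a + Q₇ 6 b ≢ + M
    no-solution a b e = no-representation ℤ.∣ x ∣ ℤ.∣ y ∣ (ℤ.+-injective (begin
      + (ℤ.∣ x ∣ ℕ.* ℤ.∣ x ∣ ℕ.+ ℤ.∣ y ∣ ℕ.* ℤ.∣ y ∣)          ≡⟨ ℤ.pos-+ (ℤ.∣ x ∣ ℕ.* ℤ.∣ x ∣) _ ⟩
      + (ℤ.∣ x ∣ ℕ.* ℤ.∣ x ∣) + + (ℤ.∣ y ∣ ℕ.* ℤ.∣ y ∣)      ≡⟨ cong₂ _+_ (+∣x∣² x) (+∣x∣² y) ⟩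
      x * x + y * y                                          ≡⟨ complete-squares a b ⟩
      + 28 * (Q₇ 5 a + Q₇ 6 b) + + 61                        ≡⟨ cong (λ z → + 28 * z + + 61) e ⟩
      + 28 * + M + + 61                                      ≡⟨ cong (_+ + 61) (ℤ.pos-* 28 M) ⟨
      + (28 ℕ.* M ℕ.+ 61)                                    ∎))
      where
      open ≡-Reasoning
      x : ℤ
      x = + 14 * a + + 5
      y : ℤ
      y = + 14 * b + + 6

module Dissection where

  open import Data.Bool using (Bool)
  open import Data.Nat using (ℕ)
  open import Relation.Binary.PropositionalEquality
  import Relation.Binary.Reasoning.Setoid (ℕ →-setoid Bool) as ≗-Reasoning

  open PowerSeries
  open ThetaIdentities

  oddPart-ϑ₄·ϑ₂ : oddPart (ϑ 4 · ϑ 2) ≗ shift (ϑ 6 · ϑ 4)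
  oddPart-ϑ₄·ϑ₂ = begin
    oddPart (ϑ 4 · ϑ 2)
      ≈⟨ oddPart-· (ϑ 4) (ϑ 2) ⟩
    oddPart (ϑ 4) · evenPart (ϑ 2) ⊕ evenPart (ϑ 4) · oddPart (ϑ 2)
      ≈⟨ ⊕-cong (·-cong oddPart-ϑ₄ evenPart-ϑ₂) (·-cong evenPart-ϑ₄ oddPart-ϑ₂) ⟩
    shift (dilate (ϑ 5)) · dilate (ϑ 1) ⊕ dilate (ϑ 2) · dilate (shift (ϑ 6))
      ≈⟨ ⊕-cong (shift-·ˡ (dilate (ϑ 5)) (dilate (ϑ 1))) (dilate-· (ϑ 2) (shift (ϑ 6))) ⟩
    shift (dilate (ϑ 5) · dilate (ϑ 1)) ⊕ dilate (ϑ 2 · shift (ϑ 6))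
      ≈⟨ ⊕-cong (shift-cong (dilate-· (ϑ 5) (ϑ 1))) (dilate-cong (shift-·ʳ (ϑ 2) (ϑ 6))) ⟩
    shift (dilate (ϑ 5 · ϑ 1)) ⊕ dilate (shift (ϑ 2 · ϑ 6))
      ≈⟨ ⊕-congˡ {f = shift (dilate (ϑ 5 · ϑ 1))} (dilate-shift (ϑ 2 · ϑ 6)) ⟩
    shift (dilate (ϑ 5 · ϑ 1)) ⊕ shift (shift (dilate (ϑ 2 · ϑ 6)))
      ≈⟨ shift-⊕ (dilate (ϑ 5 · ϑ 1)) (shift (dilate (ϑ 2 · ϑ 6))) ⟨
    shift (dilate (ϑ 5 · ϑ 1) ⊕ shift (dilate (ϑ 2 · ϑ 6)))
      ≈⟨ shift-cong ϑ-product ⟨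
    shift (ϑ 6 · ϑ 4) ∎
    where open ≗-Reasoning

  evenPart-1/ϑ₄ : ∀ {F} → F · ϑ 4 ≗ 1# → evenPart F · ϑ 4 ≗ dilate (ϑ 2)
  evenPart-1/ϑ₄ F·ϑ₄≗1 n = trans (evenPart-quotient F·ϑ₄≗1 n) (trans (evenPart-cong (·-identityˡ (ϑ 4)) n) (evenPart-ϑ₄ n))

  oddPart-ϑ₂[q²]/ϑ₄ : ∀ {F} → F · ϑ 4 ≗ dilate (ϑ 2) → oddPart F · ϑ 4 ≗ shift (dilate (ϑ 5)) · ϑ 2
  oddPart-ϑ₂[q²]/ϑ₄ {F} F·ϑ₄≗ϑ₂[q²] = begin
    oddPart F · ϑ 4                   ≈⟨ oddPart-quotient F·ϑ₄≗ϑ₂[q²] ⟩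
    oddPart (dilate (ϑ 2) · ϑ 4)      ≈⟨ oddPart-cong (·-comm (dilate (ϑ 2)) (ϑ 4)) ⟩
    oddPart (ϑ 4 · dilate (ϑ 2))      ≈⟨ oddPart-·-dilate (ϑ 4) (ϑ 2) ⟩
    oddPart (ϑ 4) · ϑ 2               ≈⟨ ·-congʳ oddPart-ϑ₄ ⟩
    shift (dilate (ϑ 5)) · ϑ 2        ∎
    where open ≗-Reasoning

  evenPart-qϑ₅[q²]ϑ₂/ϑ₄ : ∀ {F} → F · ϑ 4 ≗ shift (dilate (ϑ 5)) · ϑ 2 → evenPart F · ϑ 4 ≗ shift (shift (ϑ 5 · ϑ 6)) · ϑ 4
  evenPart-qϑ₅[q²]ϑ₂/ϑ₄ {F} F·ϑ₄≗qϑ₅[q²]ϑ₂ = begin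
    evenPart F · ϑ 4                                 ≈⟨ evenPart-quotient F·ϑ₄≗qϑ₅[q²]ϑ₂ ⟩
    evenPart ((shift (dilate (ϑ 5)) · ϑ 2) · ϑ 4)    ≈⟨ evenPart-cong shift-out ⟩
    evenPart (shift ((ϑ 4 · ϑ 2) · dilate (ϑ 5)))    ≈⟨ evenPart-shift _ ⟩
    shift (oddPart ((ϑ 4 · ϑ 2) · dilate (ϑ 5)))     ≈⟨ shift-cong (oddPart-·-dilate (ϑ 4 · ϑ 2) (ϑ 5)) ⟩
    shift (oddPart (ϑ 4 · ϑ 2) · ϑ 5)                ≈⟨ shift-cong (·-congʳ oddPart-ϑ₄·ϑ₂) ⟩
    shift (shift (ϑ 6 · ϑ 4) · ϑ 5)                  ≈⟨ shift-cong shift-in ⟩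
    shift (shift ((ϑ 5 · ϑ 6) · ϑ 4))                ≈⟨ shift-cong (shift-·ˡ (ϑ 5 · ϑ 6) (ϑ 4)) ⟨
    shift (shift (ϑ 5 · ϑ 6) · ϑ 4)                  ≈⟨ shift-·ˡ (shift (ϑ 5 · ϑ 6)) (ϑ 4) ⟨
    shift (shift (ϑ 5 · ϑ 6)) · ϑ 4                  ∎
    where
    open ≗-Reasoning
    shift-out : (shift (dilate (ϑ 5)) · ϑ 2) · ϑ 4 ≗ shift ((ϑ 4 · ϑ 2) · dilate (ϑ 5))
    shift-out = begin
      (shift (dilate (ϑ 5)) · ϑ 2) · ϑ 4    ≈⟨ ·-assoc (shift (dilate (ϑ 5))) (ϑ 2) (ϑ 4) ⟩
      shift (dilate (ϑ 5)) · (ϑ 2 · ϑ 4)    ≈⟨ shift-·ˡ (dilate (ϑ 5)) (ϑ 2 · ϑ 4) ⟩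
      shift (dilate (ϑ 5) · (ϑ 2 · ϑ 4))    ≈⟨ shift-cong (·-comm (dilate (ϑ 5)) (ϑ 2 · ϑ 4)) ⟩
      shift ((ϑ 2 · ϑ 4) · dilate (ϑ 5))    ≈⟨ shift-cong (·-congʳ (·-comm (ϑ 2) (ϑ 4))) ⟩
      shift ((ϑ 4 · ϑ 2) · dilate (ϑ 5))    ∎
    shift-in : shift (ϑ 6 · ϑ 4) · ϑ 5 ≗ shift ((ϑ 5 · ϑ 6) · ϑ 4)
    shift-in = begin
      shift (ϑ 6 · ϑ 4) · ϑ 5               ≈⟨ shift-·ˡ (ϑ 6 · ϑ 4) (ϑ 5) ⟩
      shift ((ϑ 6 · ϑ 4) · ϑ 5)             ≈⟨ shift-cong (·-assoc (ϑ 6) (ϑ 4) (ϑ 5)) ⟩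
      shift (ϑ 6 · (ϑ 4 · ϑ 5))             ≈⟨ shift-cong (·-congˡ (·-comm (ϑ 4) (ϑ 5))) ⟩
      shift (ϑ 6 · (ϑ 5 · ϑ 4))             ≈⟨ shift-cong (·-assoc (ϑ 6) (ϑ 5) (ϑ 4)) ⟨
      shift ((ϑ 6 · ϑ 5) · ϑ 4)             ≈⟨ shift-cong (·-congʳ (·-comm (ϑ 6) (ϑ 5))) ⟩
      shift ((ϑ 5 · ϑ 6) · ϑ 4)             ∎

  dissected-inverse : ∀ F → F · ϑ 4 ≗ 1# → evenPart (oddPart (evenPart F)) ≗ shift (shift (ϑ 5 · ϑ 6))
  dissected-inverse F F·ϑ₄≗1 =
    ·-cancelʳ {ϑ 4} _ _ refl (evenPart-qϑ₅[q²]ϑ₂/ϑ₄ (oddPart-ϑ₂[q²]/ϑ₄ (evenPart-1/ϑ₄ F·ϑ₄≗1)))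

module Coefficients where

  open import Data.Bool using (Bool; true; false; _xor_; _∧_)
  open import Data.Bool.Properties using (xor-same; xor-comm; ∧-identityʳ)
  open import Data.Integer as ℤ using (ℤ; +_; -[1+_]; _*_; -_)
  open import Data.List using (_∷_; map; zipWith; upTo; applyUpTo; downFrom)
  open import Data.List.Properties using (map-upTo; map-applyUpTo)
  open import Data.Nat as ℕ using (ℕ; zero; suc; _∸_; _≡ᵇ_; _%_; _/_)
  import Data.Nat.Properties as ℕ
  open import Data.Nat.DivMod using (m*n/n≡m)
  import Data.Nat.Tactic.RingSolver as ℕ-Ring
  open import Data.Product using (∃; _,_)
  open import Function using (_∘_)
  open import Relation.Binary.PropositionalEquality

  open import Defs
  open PowerSeries
  open XorSums
  open Parity
  open ThetaSeries
  open ThetaIdentities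

  parity-sumℤ : ∀ n g → parity (sumℤ (applyUpTo g n)) ≡ xorSum n (parity ∘ g)
  parity-sumℤ zero    g = parity-0
  parity-sumℤ (suc n) g = trans (parity-+ (g 0) _) (cong (parity (g 0) xor_) (parity-sumℤ n (g ∘ suc)))

  parity-convolution : ∀ n (h d : ℕ → ℤ) →
    parity (sumℤ (zipWith _*_ (applyUpTo h n) (map d (downFrom n)))) ≡ xorSum n (λ i → parity (h i) ∧ parity (d (n ∸ suc i)))
  parity-convolution zero    h d = parity-0
  parity-convolution (suc n) h d =
    trans (parity-+ (h 0 * d n) _) (cong₂ _xor_ (parity-* (h 0) (d n)) (parity-convolution n (h ∘ suc) d))

  revCoeffs≡c-downFrom : ∀ r s N → revCoeffs r s N ≡ map (c r s) (downFrom (suc N))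
  revCoeffs≡c-downFrom r s zero    = refl
  revCoeffs≡c-downFrom r s (suc N) = cong (c r s (suc N) ∷_) (revCoeffs≡c-downFrom r s N)

  parity-c-suc : ∀ r s N →
    parity (c r s (suc N)) ≡ xorSum (suc N) (λ i → parity (psiCoeff r s (suc i)) ∧ parity (c r s (N ∸ i)))
  parity-c-suc r s N = begin
    parity (- sumℤ (zipWith _*_ (map a (upTo (suc N))) (revCoeffs r s N)))
      ≡⟨ parity-neg _ ⟩
    parity (sumℤ (zipWith _*_ (map a (upTo (suc N))) (revCoeffs r s N)))
      ≡⟨ cong₂ (λ xs ys → parity (sumℤ (zipWith _*_ xs ys))) (map-upTo a (suc N)) (revCoeffs≡c-downFrom r s N) ⟩
    parity (sumℤ (zipWith _*_ (applyUpTo a (suc N)) (map (c r s) (downFrom (suc N)))))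
      ≡⟨ parity-convolution (suc N) a (c r s) ⟩
    xorSum (suc N) (λ i → parity (a i) ∧ parity (c r s (N ∸ i))) ∎
    where
    open ≡-Reasoning
    a : ℕ → ℤ
    a j = psiCoeff r s (suc j)

  psiCoeff-0 : ∀ r s → psiCoeff r s 0 ≡ ℤ.1ℤ
  psiCoeff-0 r s rewrite ℕ.*-zeroʳ r | ℕ.*-zeroʳ s = refl

  parity-Ψ·parity-c : ∀ r s → (parity ∘ psiCoeff r s) · (parity ∘ c r s) ≗ 1#
  parity-Ψ·parity-c r s zero    rewrite psiCoeff-0 r s = refl
  parity-Ψ·parity-c r s (suc N) rewrite psiCoeff-0 r s = begin
    parity (c r s (suc N)) xor (tail (parity ∘ psiCoeff r s) · (parity ∘ c r s)) N
      ≡⟨ cong (parity (c r s (suc N)) xor_) (trans (·-coefficient _ _ N) (sym (parity-c-suc r s N))) ⟩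
    parity (c r s (suc N)) xor parity (c r s (suc N))
      ≡⟨ xor-same (parity (c r s (suc N))) ⟩
    false ∎
    where open ≡-Reasoning

  private
    tri-double : ∀ n → tri n ℕ.* 2 ≡ n ℕ.* suc n
    tri-double n with pronic-even n
      where
      pronic-even : ∀ n → ∃ λ t → n ℕ.* suc n ≡ t ℕ.* 2
      pronic-even zero    = 0 , refl
      pronic-even (suc n) with pronic-even n
      ... | t , e = t ℕ.+ suc n , trans (step n) (trans (cong (ℕ._+ suc n ℕ.* 2) e) (sym (ℕ.*-distribʳ-+ 2 t (suc n))))
        where step : ∀ n → suc n ℕ.* suc (suc n) ≡ n ℕ.* suc n ℕ.+ suc n ℕ.* 2
              step = ℕ-Ring.solve-∀
    ... | t , e = trans (cong (ℕ._* 2) (trans (cong (_/ 2) e) (m*n/n≡m t 2))) (sym e)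

    halve : ∀ {x y} → x ℕ.* 2 ≡ y ℕ.* 2 → x ≡ y
    halve {x} {y} = ℕ.*-cancelʳ-≡ x y 2

    exponent⁺ : ∀ n → 11 ℕ.* tri n ℕ.+ 3 ℕ.* tri (n ∸ 1) ≡ 7 ℕ.* n ℕ.* n ℕ.+ 4 ℕ.* n
    exponent⁺ zero    = refl
    exponent⁺ (suc k) = halve (trans (distrib (tri (suc k)) (tri k))
                                     (trans (cong₂ (λ a b → 11 ℕ.* a ℕ.+ 3 ℕ.* b) (tri-double (suc k)) (tri-double k)) (expand k)))
      where
      distrib : ∀ a b → (11 ℕ.* a ℕ.+ 3 ℕ.* b) ℕ.* 2 ≡ 11 ℕ.* (a ℕ.* 2) ℕ.+ 3 ℕ.* (b ℕ.* 2)
      distrib = ℕ-Ring.solve-∀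
      expand : ∀ k → 11 ℕ.* (suc k ℕ.* suc (suc k)) ℕ.+ 3 ℕ.* (k ℕ.* suc k) ≡ (7 ℕ.* suc k ℕ.* suc k ℕ.+ 4 ℕ.* suc k) ℕ.* 2
      expand = ℕ-Ring.solve-∀

    exponent⁻ : ∀ k → 11 ℕ.* tri k ℕ.+ 3 ℕ.* tri (suc k) ≡ suc k ℕ.* (7 ℕ.* k ℕ.+ 3)
    exponent⁻ k = halve (trans (distrib (tri k) (tri (suc k)))
                               (trans (cong₂ (λ a b → 11 ℕ.* a ℕ.+ 3 ℕ.* b) (tri-double k) (tri-double (suc k))) (expand k)))
      where
      distrib : ∀ a b → (11 ℕ.* a ℕ.+ 3 ℕ.* b) ℕ.* 2 ≡ 11 ℕ.* (a ℕ.* 2) ℕ.+ 3 ℕ.* (b ℕ.* 2)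
      distrib = ℕ-Ring.solve-∀
      expand : ∀ k → 11 ℕ.* (k ℕ.* suc k) ℕ.+ 3 ℕ.* (suc k ℕ.* suc (suc k)) ≡ (suc k ℕ.* (7 ℕ.* k ℕ.+ 3)) ℕ.* 2
      expand = ℕ-Ring.solve-∀

    parity-sgn : ∀ k → parity (sgn k) ≡ true
    parity-sgn k with (k % 2) ≡ᵇ 0
    ... | true  = parity-odd (+ 1) (+ 0) refl
    ... | false = parity-odd (- + 1) (- + 1) refl

    parity-mono : ∀ N ε e → parity (mono N ε e) ≡ (e ≡ᵇ N) ∧ parity ε
    parity-mono N ε e with e ≡ᵇ N
    ... | true  = refl
    ... | false = parity-0

    parity-term : ∀ N k e m → Q₇ 4 m ≡ + e → parity (mono N (sgn k) e) ≡ level (Q₇ 4) N m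
    parity-term N k e m Q≡e = begin
      parity (mono N (sgn k) e)   ≡⟨ parity-mono N (sgn k) e ⟩
      (e ≡ᵇ N) ∧ parity (sgn k)   ≡⟨ cong ((e ≡ᵇ N) ∧_) (parity-sgn k) ⟩
      (e ≡ᵇ N) ∧ true             ≡⟨ ∧-identityʳ _ ⟩
      (+ e == + N)                ≡⟨ cong (_== + N) Q≡e ⟨
      level (Q₇ 4) N m            ∎
      where open ≡-Reasoning

  parity-Ψ≗ϑ₄ : parity ∘ psiCoeff 11 3 ≗ ϑ 4
  parity-Ψ≗ϑ₄ N = begin
    parity (psiCoeff 11 3 N)
      ≡⟨ parity-- (sumℤ (map φ (upTo (suc N)))) (sumℤ (map ψ (map suc (upTo N)))) ⟩
    parity (sumℤ (map φ (upTo (suc N)))) xor parity (sumℤ (map ψ (map suc (upTo N))))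
      ≡⟨ cong₂ (λ xs ys → parity (sumℤ xs) xor parity (sumℤ ys))
               (map-upTo φ (suc N)) (trans (cong (map ψ) (map-upTo suc N)) (map-applyUpTo suc ψ N)) ⟩
    parity (sumℤ (applyUpTo φ (suc N))) xor parity (sumℤ (applyUpTo (ψ ∘ suc) N))
      ≡⟨ cong₂ _xor_ (parity-sumℤ (suc N) φ) (parity-sumℤ N (ψ ∘ suc)) ⟩
    xorSum (suc N) (parity ∘ φ) xor xorSum N (parity ∘ ψ ∘ suc)
      ≡⟨ cong₂ _xor_ (xorSum-cong-≗ (suc N) nonNegatives) (xorSum-cong-≗ N negatives) ⟩
    xorSum (suc N) (λ i → level (Q₇ 4) N (+ i)) xor xorSum N (λ k → level (Q₇ 4) N -[1+ k ])
      ≡⟨ xor-comm (xorSum (suc N) (λ i → level (Q₇ 4) N (+ i))) _ ⟩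
    xorSum N (λ k → level (Q₇ 4) N -[1+ k ]) xor xorSum (suc N) (λ i → level (Q₇ 4) N (+ i))
      ≡⟨ boxSum-halves N (level (Q₇ 4) N) ⟨
    ϑ 4 N ∎
    where
    open ≡-Reasoning
    φ ψ : ℕ → ℤ
    φ n = mono N (sgn (tri n)) (11 ℕ.* tri n ℕ.+ 3 ℕ.* tri (n ∸ 1))
    ψ m = mono N (sgn (tri (m ∸ 1))) (11 ℕ.* tri (m ∸ 1) ℕ.+ 3 ℕ.* tri m)
    nonNegatives : ∀ i → parity (φ i) ≡ level (Q₇ 4) N (+ i)
    nonNegatives i = parity-term N (tri i) _ (+ i) (trans (Q₇-nonNegative 4 i) (cong +_ (sym (exponent⁺ i))))
    negatives : ∀ k → parity (ψ (suc k)) ≡ level (Q₇ 4) N -[1+ k ]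
    negatives k = parity-term N (tri k) _ -[1+ k ] (trans (Q₇-negative 4 2 k refl) (cong +_ (sym (exponent⁻ k))))

module SumsOfTwoSquares where

  open import Data.Fin as Fin using (Fin; toℕ; fromℕ; inject₁)
  import Data.Fin.Properties as Fin
  open import Data.Nat as ℕ using (ℕ; zero; suc; _+_; _*_; _^_; _∸_; _<_; _≤_; z≤n; s≤s; _!; NonZero)
  open import Data.Nat.Combinatorics using (_C_; nCn≡1; nCk≡n!/k![n-k]!; k![n∸k]!∣n!)
  open import Data.Nat.DivMod using (_%_; _/_; m/n*n≡m; m≡m%n+[m/n]*n; m%n≤m)
  open import Data.Nat.Divisibility
  open import Data.Nat.Primality using (Prime; prime; euclidsLemma; prime⇒nonZero)
  import Data.Nat.Properties as ℕ
  open import Algebra.Properties.Semiring.Exp ℕ.+-*-semiring using () renaming (_^_ to _^ᴿ_)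
  import Algebra.Properties.CommutativeSemiring.Binomial ℕ.+-*-commutativeSemiring as Binomial
  open import Algebra.Properties.Monoid.Sum ℕ.+-0-monoid using (sum; sum-init-last)
  open import Algebra.Definitions.RawMonoid ℕ.+-0-rawMonoid using (_×_)
  import Data.Nat.Tactic.RingSolver as ℕ-Ring
  open import Data.Product using (∃; ∃₂; _,_; proj₁; proj₂)
  open import Data.Sum using (_⊎_; inj₁; inj₂)
  open import Function using (_∘_)
  open import Relation.Binary.PropositionalEquality
  open import Relation.Nullary using (¬_; contradiction)

  private
    variable
      p : ℕ

  prime>1 : Prime p → 1 < p
  prime>1 (prime _) = ℕ.nonTrivial⇒n>1 _

  prime∤! : Prime p → ∀ k → k < p → ¬ (p ∣ k !)
  prime∤! pr zero    _   p∣1 = contradiction (∣1⇒≡1 p∣1) (λ { refl → ℕ.<-irrefl refl (prime>1 pr) })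
  prime∤! pr (suc k) k<p p∣k! with euclidsLemma (suc k) (k !) pr p∣k!
  ... | inj₁ p∣1+k = contradiction (∣⇒≤ p∣1+k) (ℕ.<⇒≱ k<p)
  ... | inj₂ p∣k!  = prime∤! pr k (ℕ.<-trans (ℕ.n<1+n k) k<p) p∣k!

  prime∣nCk : Prime p → ∀ {k} → 0 < k → k < p → p ∣ p C k
  prime∣nCk {p} pr {k} 0<k k<p with euclidsLemma (p C k) (k ! * (p ∸ k) !) pr p∣C*k![p-k]!
    where
    instance
      k![p-k]!≢0 : NonZero (k ! * (p ∸ k) !)
      k![p-k]!≢0 = k ℕ.!* (p ∸ k) !≢0
    C*k![p-k]!≡p! : (p C k) * (k ! * (p ∸ k) !) ≡ p !
    C*k![p-k]!≡p! = trans (cong (_* (k ! * (p ∸ k) !)) (nCk≡n!/k![n-k]! (ℕ.<⇒≤ k<p))) (m/n*n≡m (k![n∸k]!∣n! (ℕ.<⇒≤ k<p)))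
    n∣n! : ∀ {n} → 0 < n → n ∣ n !
    n∣n! {suc n} _ = m∣m*n (n !)
    p∣C*k![p-k]! : p ∣ (p C k) * (k ! * (p ∸ k) !)
    p∣C*k![p-k]! = subst (p ∣_) (sym C*k![p-k]!≡p!) (n∣n! (ℕ.<-trans 0<k k<p))
  ... | inj₁ p∣C = p∣C
  ... | inj₂ p∣k![p-k]! with euclidsLemma (k !) ((p ∸ k) !) pr p∣k![p-k]!
  ...   | inj₁ p∣k!     = contradiction p∣k! (prime∤! pr k k<p)
  ...   | inj₂ p∣[p-k]! = contradiction p∣[p-k]! (prime∤! pr (p ∸ k) (ℕ.∸-monoʳ-< 0<k (ℕ.<⇒≤ k<p)))

  private
    ^ᴿ≡^ : ∀ x n → x ^ᴿ n ≡ x ^ n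
    ^ᴿ≡^ x zero    = refl
    ^ᴿ≡^ x (suc n) = cong (x *_) (^ᴿ≡^ x n)

    ×≡* : ∀ n x → n × x ≡ n * x
    ×≡* zero    x = refl
    ×≡* (suc n) x = cong (x +_) (×≡* n x)

    binomialTerm≡ : ∀ x n k → Binomial.binomialTerm x 1 n k ≡ (n C toℕ k) * x ^ toℕ k
    binomialTerm≡ x n k = begin
      (n C toℕ k) × (x ^ᴿ toℕ k * 1 ^ᴿ (n ∸ toℕ k))   ≡⟨ ×≡* (n C toℕ k) (x ^ᴿ toℕ k * 1 ^ᴿ (n ∸ toℕ k)) ⟩
      (n C toℕ k) * (x ^ᴿ toℕ k * 1 ^ᴿ (n ∸ toℕ k))   ≡⟨ cong₂ (λ a b → (n C toℕ k) * (a * b)) (^ᴿ≡^ x (toℕ k)) 1ᴿ≡1 ⟩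
      (n C toℕ k) * (x ^ toℕ k * 1)                   ≡⟨ cong ((n C toℕ k) *_) (ℕ.*-identityʳ (x ^ toℕ k)) ⟩
      (n C toℕ k) * x ^ toℕ k                         ∎
      where
      open ≡-Reasoning
      1ᴿ≡1 : 1 ^ᴿ (n ∸ toℕ k) ≡ 1
      1ᴿ≡1 = trans (^ᴿ≡^ 1 (n ∸ toℕ k)) (ℕ.^-zeroˡ (n ∸ toℕ k))

    ∣-sum : ∀ {d n} (t : Fin n → ℕ) → (∀ i → d ∣ t i) → d ∣ sum t
    ∣-sum {d} {zero}  t d∣t = d ∣0
    ∣-sum {d} {suc n} t d∣t = ∣m∣n⇒∣m+n (d∣t Fin.zero) (∣-sum (t ∘ Fin.suc) (d∣t ∘ Fin.suc))

  freshmans-dream : Prime p → ∀ x → ∃ λ M → (x + 1) ^ p ≡ x ^ p + 1 + M * p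
  freshmans-dream {zero}  pr x = contradiction (prime>1 pr) λ ()
  freshmans-dream {p@(suc m)} pr x = M , (begin
    (x + 1) ^ p                                                   ≡⟨ ^ᴿ≡^ (x + 1) p ⟨
    (x + 1) ^ᴿ p                                                  ≡⟨ Binomial.theorem p x 1 ⟩
    t Fin.zero + sum (t ∘ Fin.suc)                                ≡⟨ cong (t Fin.zero +_) (sum-init-last (t ∘ Fin.suc)) ⟩
    t Fin.zero + (sum (t ∘ Fin.suc ∘ inject₁) + t (Fin.suc (fromℕ m))) ≡⟨ cong₂ (λ a b → a + (b + t (Fin.suc (fromℕ m)))) first Σmiddle≡M*p ⟩
    1 + (M * p + t (Fin.suc (fromℕ m)))                            ≡⟨ cong (λ a → 1 + (M * p + a)) last ⟩
    1 + (M * p + x ^ p)                                           ≡⟨ rearrange 1 (M * p) (x ^ p) ⟩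
    x ^ p + 1 + M * p                                             ∎)
    where
    open ≡-Reasoning
    t : Fin (suc p) → ℕ
    t = Binomial.binomialTerm x 1 p
    middle : ∀ k → p ∣ t (Fin.suc (inject₁ k))
    middle k = subst (p ∣_) (sym (binomialTerm≡ x p (Fin.suc (inject₁ k)))) (∣m⇒∣m*n _ (prime∣nCk pr (s≤s z≤n) (s≤s j<m)))
      where j<m : toℕ (inject₁ k) < m
            j<m = subst (_< m) (sym (Fin.toℕ-inject₁ k)) (Fin.toℕ<n k)
    M : ℕ
    M = _∣_.quotient (∣-sum (t ∘ Fin.suc ∘ inject₁) middle)
    Σmiddle≡M*p : sum (t ∘ Fin.suc ∘ inject₁) ≡ M * p
    Σmiddle≡M*p = _∣_.equality (∣-sum (t ∘ Fin.suc ∘ inject₁) middle)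
    first : t Fin.zero ≡ 1
    first = binomialTerm≡ x p Fin.zero
    last : t (Fin.suc (fromℕ m)) ≡ x ^ p
    last = begin
      t (Fin.suc (fromℕ m))                ≡⟨ binomialTerm≡ x p (Fin.suc (fromℕ m)) ⟩
      (p C suc (toℕ (fromℕ m))) * x ^ suc (toℕ (fromℕ m)) ≡⟨ cong (λ j → (p C suc j) * x ^ suc j) (Fin.toℕ-fromℕ m) ⟩
      (p C p) * x ^ p                      ≡⟨ cong (_* x ^ p) (nCn≡1 p) ⟩
      1 * x ^ p                            ≡⟨ ℕ.*-identityˡ _ ⟩
      x ^ p                                ∎
    rearrange : ∀ a b c → a + (b + c) ≡ c + a + b
    rearrange = ℕ-Ring.solve-∀

  fermat : Prime p → ∀ a → ∃ λ k → a ^ p ≡ a + k * p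
  fermat {zero}  pr _       = contradiction (prime>1 pr) λ ()
  fermat {suc m} pr zero    = 0 , refl
  fermat {p}     pr (suc a) with fermat pr a | freshmans-dream pr a
  ... | k , aᵖ≡a+kp | M , [a+1]ᵖ≡aᵖ+1+Mp = k + M , (begin
    suc a ^ p                 ≡⟨ cong (_^ p) (ℕ.+-comm 1 a) ⟩
    (a + 1) ^ p               ≡⟨ [a+1]ᵖ≡aᵖ+1+Mp ⟩
    a ^ p + 1 + M * p         ≡⟨ cong (λ z → z + 1 + M * p) aᵖ≡a+kp ⟩
    a + k * p + 1 + M * p     ≡⟨ collect a k M p ⟩
    suc a + (k + M) * p       ∎)
    where
    open ≡-Reasoning
    collect : ∀ a k M p → a + k * p + 1 + M * p ≡ suc a + (k + M) * p
    collect = ℕ-Ring.solve-∀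

  sum∣sum-of-odd-powers : ∀ a b h → a + b ∣ a ^ (1 + 2 * h) + b ^ (1 + 2 * h)
  sum∣sum-of-odd-powers a b zero    = ∣-reflexive (cong₂ _+_ (sym (ℕ.*-identityʳ a)) (sym (ℕ.*-identityʳ b)))
  sum∣sum-of-odd-powers a b (suc h) = subst (λ n → a + b ∣ a ^ n + b ^ n) (sym (two-more h)) a+b∣next
    where
    n : ℕ
    n = 1 + 2 * h
    two-more : ∀ h → 1 + 2 * suc h ≡ 2 + (1 + 2 * h)
    two-more = ℕ-Ring.solve-∀
    expand : ∀ a b A B → (a + b) * (a * A + b * B) ≡ a * b * (A + B) + (a * (a * A) + b * (b * B))
    expand = ℕ-Ring.solve-∀
    a+b∣next : a + b ∣ a ^ (2 + n) + b ^ (2 + n)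
    a+b∣next = ∣m+n∣m⇒∣n (subst (a + b ∣_) (expand a b (a ^ n) (b ^ n)) (m∣m*n _)) (∣n⇒∣m*n (a * b) (sum∣sum-of-odd-powers a b h))

  -- With p = 1 + 2h and h odd: x² + y² ∣ (x²)ʰ + (y²)ʰ, so p ∣ xy((x²)ʰ + (y²)ʰ) = y·xᵖ + x·yᵖ ≡ 2xy (mod p).
  prime≡3mod4∣sum-of-squares⇒∣2xy : Prime p → p % 4 ≡ 3 → ∀ {x y} → p ∣ x * x + y * y → p ∣ 2 * (x * y)
  prime≡3mod4∣sum-of-squares⇒∣2xy {p} pr p%4≡3 {x} {y} p∣x²+y² =
    ∣m+n∣m⇒∣n (subst (p ∣_) combined (∣n⇒∣m*n (x * y) p∣powers)) (n∣m*n (y * k + x * l))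
    where
    open ≡-Reasoning
    j : ℕ
    j = p / 4
    h : ℕ
    h = 1 + 2 * j
    p≡1+2h : p ≡ 1 + 2 * h
    p≡1+2h = trans (m≡m%n+[m/n]*n p 4) (trans (cong (_+ j * 4) p%4≡3) (regroup j))
      where regroup : ∀ j → 3 + j * 4 ≡ 1 + 2 * (1 + 2 * j)
            regroup = ℕ-Ring.solve-∀
    odd-power : ∀ z → z ^ p ≡ z * (z * z) ^ h
    odd-power z = trans (cong (z ^_) p≡1+2h) (cong (z *_) (trans (sym (ℕ.^-*-assoc z 2 h)) (cong (λ w → (z * w) ^ h) (ℕ.*-identityʳ z))))
    p∣powers : p ∣ (x * x) ^ h + (y * y) ^ h
    p∣powers = ∣-trans p∣x²+y² (sum∣sum-of-odd-powers (x * x) (y * y) j)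
    k l : ℕ
    k = proj₁ (fermat pr x)
    l = proj₁ (fermat pr y)
    distribute : ∀ x y X Y → x * y * (X + Y) ≡ y * (x * X) + x * (y * Y)
    distribute = ℕ-Ring.solve-∀
    collect : ∀ x y k l p → y * (x + k * p) + x * (y + l * p) ≡ (y * k + x * l) * p + 2 * (x * y)
    collect = ℕ-Ring.solve-∀
    combined : x * y * ((x * x) ^ h + (y * y) ^ h) ≡ (y * k + x * l) * p + 2 * (x * y)
    combined = begin
      x * y * ((x * x) ^ h + (y * y) ^ h)            ≡⟨ distribute x y ((x * x) ^ h) ((y * y) ^ h) ⟩
      y * (x * (x * x) ^ h) + x * (y * (y * y) ^ h)  ≡⟨ cong₂ (λ a b → y * a + x * b) (odd-power x) (odd-power y) ⟨
      y * x ^ p + x * y ^ p                          ≡⟨ cong₂ (λ a b → y * a + x * b) (proj₂ (fermat pr x)) (proj₂ (fermat pr y)) ⟩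
      y * (x + k * p) + x * (y + l * p)              ≡⟨ collect x y k l p ⟩
      (y * k + x * l) * p + 2 * (x * y)              ∎

  prime≡3mod4∣sum-of-squares : Prime p → p % 4 ≡ 3 → ∀ {x y} → p ∣ x * x + y * y → p ∣ x
  prime≡3mod4∣sum-of-squares {p} pr p%4≡3 {x} {y} p∣x²+y² =
    p∣x (euclidsLemma 2 (x * y) pr (prime≡3mod4∣sum-of-squares⇒∣2xy pr p%4≡3 {x} {y} p∣x²+y²))
    where
    p∣x : p ∣ 2 ⊎ p ∣ x * y → p ∣ x
    p∣x (inj₁ p∣2)  = contradiction (∣⇒≤ p∣2) (ℕ.<⇒≱ (subst (_≤ p) p%4≡3 (m%n≤m p 4)))
    p∣x (inj₂ p∣xy) with euclidsLemma x y pr p∣xy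
    ... | inj₁ p∣x = p∣x
    ... | inj₂ p∣y with euclidsLemma x x pr (∣m+n∣m⇒∣n (subst (p ∣_) (ℕ.+-comm (x * x) (y * y)) p∣x²+y²) (∣m⇒∣m*n y p∣y))
    ...   | inj₁ p∣x = p∣x
    ...   | inj₂ p∣x = p∣x

  prime²∣sum-of-squares : Prime p → p % 4 ≡ 3 → ∀ {x y} → p ∣ x * x + y * y →
                          ∃₂ λ X Y → x * x + y * y ≡ p * p * (X * X + Y * Y)
  prime²∣sum-of-squares {p} pr p%4≡3 {x} {y} p∣x²+y² = X , Y , (begin
    x * x + y * y                       ≡⟨ cong₂ (λ a b → a * a + b * b) (equality p∣x) (equality p∣y) ⟩
    X * p * (X * p) + Y * p * (Y * p)   ≡⟨ factor X Y p ⟩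
    p * p * (X * X + Y * Y)             ∎)
    where
    open ≡-Reasoning
    open _∣_ using (quotient; equality)
    p∣x : p ∣ x
    p∣x = prime≡3mod4∣sum-of-squares pr p%4≡3 {x} {y} p∣x²+y²
    p∣y : p ∣ y
    p∣y = prime≡3mod4∣sum-of-squares pr p%4≡3 {y} {x} (subst (p ∣_) (ℕ.+-comm (x * x) (y * y)) p∣x²+y²)
    X : ℕ
    X = quotient p∣x
    Y : ℕ
    Y = quotient p∣y
    factor : ∀ X Y p → X * p * (X * p) + Y * p * (Y * p) ≡ p * p * (X * X + Y * Y)
    factor = ℕ-Ring.solve-∀

  sum-of-squares-cofactor : Prime p → p % 4 ≡ 3 → ∀ k {x y u} → x * x + y * y ≡ p ^ (2 * k + 1) * u → p ∣ u
  sum-of-squares-cofactor {p} pr p%4≡3 k {x} {y} {u} e = descend k (trans (sym x²+y²≡p²S) e)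
    where
    instance
      p≢0 : NonZero p
      p≢0 = prime⇒nonZero pr
      p²≢0 : NonZero (p * p)
      p²≢0 = ℕ.m*n≢0 p p
    p∣x²+y² : p ∣ x * x + y * y
    p∣x²+y² = subst (p ∣_) (sym e) (∣m⇒∣m*n u (subst (p ∣_) (cong (p ^_) (ℕ.+-comm 1 (2 * k))) (m∣m*n (p ^ (2 * k)))))
    squares : ∃₂ λ X Y → x * x + y * y ≡ p * p * (X * X + Y * Y)
    squares = prime²∣sum-of-squares pr p%4≡3 {x} {y} p∣x²+y²
    X : ℕ
    X = proj₁ squares
    Y : ℕ
    Y = proj₁ (proj₂ squares)
    x²+y²≡p²S : x * x + y * y ≡ p * p * (X * X + Y * Y)
    x²+y²≡p²S = proj₂ (proj₂ squares)
    S : ℕ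
    S = X * X + Y * Y
    descend : ∀ k → p * p * S ≡ p ^ (2 * k + 1) * u → p ∣ u
    descend zero    p²S≡pu = divides S (ℕ.*-cancelˡ-≡ u (S * p) p (begin
      p * u          ≡⟨ cong (_* u) (ℕ.*-identityʳ p) ⟨
      p ^ 1 * u      ≡⟨ p²S≡pu ⟨
      p * p * S      ≡⟨ ℕ.*-assoc p p S ⟩
      p * (p * S)    ≡⟨ cong (p *_) (ℕ.*-comm p S) ⟩
      p * (S * p)    ∎))
      where open ≡-Reasoning
    descend (suc k) p²S≡ = sum-of-squares-cofactor pr p%4≡3 k {X} {Y} (ℕ.*-cancelˡ-≡ S (p ^ (2 * k + 1) * u) (p * p) (begin
      p * p * S                        ≡⟨ p²S≡ ⟩
      p ^ (2 * suc k + 1) * u          ≡⟨ cong (λ n → p ^ n * u) (two-more k) ⟩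
      p * (p * p ^ (2 * k + 1)) * u    ≡⟨ regroup p (p ^ (2 * k + 1)) u ⟩
      p * p * (p ^ (2 * k + 1) * u)    ∎))
      where
      open ≡-Reasoning
      two-more : ∀ k → 2 * suc k + 1 ≡ 2 + (2 * k + 1)
      two-more = ℕ-Ring.solve-∀
      regroup : ∀ p P u → p * (p * P) * u ≡ p * p * (P * u)
      regroup = ℕ-Ring.solve-∀

open import Defs
open import Data.Nat using (ℕ; _+_; _*_; _^_)
open import Data.Nat.DivMod using (_/_; _%_)
open import Data.Nat.Divisibility as ℕD using ()
open import Data.Nat.Primality using (Prime)
open import Data.Integer using (+_)
open import Data.Integer.Divisibility as ℤD using ()
open import Data.Sum using (_⊎_)
open import Relation.Nullary using (¬_)
open import Relation.Binary.PropositionalEquality using (_≡_)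

open import Data.Bool using (false)
open import Data.Nat as ℕ using (zero; suc; _≤_; _<_)
import Data.Nat.Properties as ℕ
open import Data.Nat.DivMod using (m≡m%n+[m/n]*n; m*n/n≡m; m∣n⇒o%n%m≡o%m)
open import Data.Nat.Divisibility using (_∣_; divides; ∣⇒≤; ∣m+n∣m⇒∣n; n∣m*n)
open import Data.Nat.Primality using (euclidsLemma)
import Data.Nat.Tactic.RingSolver as ℕ-Ring
open import Data.Product using (∃; _×_; _,_; proj₁; proj₂)
open import Data.Sum using (inj₁; inj₂)
open import Function using (_∘_)
open import Relation.Binary.PropositionalEquality using (_≢_; refl; sym; trans; cong; cong₂; subst; _≗_; module ≡-Reasoning)

open PowerSeries
open Parity using (parity; parity≡false⇒2∣)
open ThetaIdentities using (ϑ; ϑ₅·ϑ₆-vanishes)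
open Dissection using (dissected-inverse)
open Coefficients using (parity-Ψ≗ϑ₄; parity-Ψ·parity-c)
open SumsOfTwoSquares using (sum-of-squares-cofactor)

parity-c·ϑ₄ : (parity ∘ c 11 3) · ϑ 4 ≗ 1#
parity-c·ϑ₄ n = trans (·-comm (parity ∘ c 11 3) (ϑ 4) n)
                      (trans (·-congʳ (λ m → sym (parity-Ψ≗ϑ₄ m)) n) (parity-Ψ·parity-c 11 3 n))

parity-c[8M+18] : ∀ M → parity (c 11 3 (8 * M + 18)) ≡ (ϑ 5 · ϑ 6) M
parity-c[8M+18] M =
  trans (cong (parity ∘ c 11 3) (sym index)) (dissected-inverse (parity ∘ c 11 3) parity-c·ϑ₄ (2 + M))
  where
  open ≡-Reasoning
  x : ℕ
  x = 2 + M
  index : double (suc (double (double x))) ≡ 8 * M + 18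
  index = begin
    double (suc (double (double x)))                   ≡⟨ double≡+ (suc (double (double x))) ⟩
    suc (double (double x)) + suc (double (double x))  ≡⟨ cong (λ z → suc z + suc z) (trans (double≡+ (double x)) (cong (λ z → z + z) (double≡+ x))) ⟩
    suc ((x + x) + (x + x)) + suc ((x + x) + (x + x))  ≡⟨ expand M ⟩
    8 * M + 18                                         ∎
    where expand : ∀ M → suc ((2 + M + (2 + M)) + (2 + M + (2 + M))) + suc ((2 + M + (2 + M)) + (2 + M + (2 + M))) ≡ 8 * M + 18
          expand = ℕ-Ring.solve-∀

Residue : ℕ → Set
Residue p = p % 28 ≡ 15 ⊎ p % 28 ≡ 27

private
  variable
    p : ℕ

residue⇒≡3-mod-4 : Residue p → p % 4 ≡ 3
residue⇒≡3-mod-4 {p} residue = trans (sym (m∣n⇒o%n%m≡o%m 4 28 p (divides 7 refl))) (mod-4 residue)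
  where
  mod-4 : Residue p → p % 28 % 4 ≡ 3
  mod-4 (inj₁ p≡15) = cong (_% 4) p≡15
  mod-4 (inj₂ p≡27) = cong (_% 4) p≡27

residue⇒15≤ : Residue p → 15 ≤ p
residue⇒15≤ {p} residue = subst (15 ≤_) (sym (m≡m%n+[m/n]*n p 28)) (ℕ.≤-trans (lower residue) (ℕ.m≤m+n (p % 28) _))
  where
  lower : Residue p → 15 ≤ p % 28
  lower (inj₁ p≡15) = ℕ.≤-reflexive (sym p≡15)
  lower (inj₂ p≡27) = subst (15 ≤_) (sym p≡27) (ℕ.m≤m+n 15 12)

residue⇒square≡1 : Residue p → ∃ λ t → p * p ≡ 1 + t * 28
residue⇒square≡1 {p} residue with square-of-residue residue
  where
  square-of-residue : Residue p → ∃ λ s → p % 28 * (p % 28) ≡ 1 + s * 28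
  square-of-residue (inj₁ p≡15) = 8 , cong₂ _*_ p≡15 p≡15
  square-of-residue (inj₂ p≡27) = 26 , cong₂ _*_ p≡27 p≡27
... | s , r²≡1+28s = s + (2 * r * q + 28 * q * q) , (begin
  p * p                                   ≡⟨ cong₂ _*_ (m≡m%n+[m/n]*n p 28) (m≡m%n+[m/n]*n p 28) ⟩
  (r + q * 28) * (r + q * 28)             ≡⟨ expand r q ⟩
  r * r + (2 * r * q + 28 * q * q) * 28   ≡⟨ cong (_+ (2 * r * q + 28 * q * q) * 28) r²≡1+28s ⟩
  1 + s * 28 + (2 * r * q + 28 * q * q) * 28 ≡⟨ collect s (2 * r * q + 28 * q * q) ⟩
  1 + (s + (2 * r * q + 28 * q * q)) * 28 ∎)
  where
  open ≡-Reasoning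
  r : ℕ
  r = p % 28
  q : ℕ
  q = p / 28
  expand : ∀ r q → (r + q * 28) * (r + q * 28) ≡ r * r + (2 * r * q + 28 * q * q) * 28
  expand = ℕ-Ring.solve-∀
  collect : ∀ s u → 1 + s * 28 + u * 28 ≡ 1 + (s + u) * 28
  collect = ℕ-Ring.solve-∀

^-≡1-mod : ∀ {a t d} → a ≡ 1 + t * d → ∀ n → ∃ λ T → a ^ n ≡ 1 + T * d
^-≡1-mod         a≡1+td zero    = 0 , refl
^-≡1-mod {a} {t} {d} a≡1+td (suc n) with ^-≡1-mod {t = t} a≡1+td n
... | T , aⁿ≡1+Td = t + T + t * T * d , trans (cong₂ _*_ a≡1+td aⁿ≡1+Td) (expand t T d)
  where expand : ∀ t T d → (1 + t * d) * (1 + T * d) ≡ 1 + (t + T + t * T * d) * d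
        expand = ℕ-Ring.solve-∀

-- With p^(2k+2) = 1 + 28T: the index is 8M + 18 and 28M + 61 = p^(2k+1)(28n + 61p), where M = p^(2k+1)n + 61T.
progression : Residue p → ∀ n k → ∃ λ M →
              8 * p ^ (2 * k + 1) * n + (122 * p ^ (2 * k + 2) + 4) / 7 ≡ 8 * M + 18 ×
              28 * M + 61 ≡ p ^ (2 * k + 1) * (28 * n + 61 * p)
progression {p} residue n k = A * n + 61 * T , index , cofactor
  where
  open ≡-Reasoning
  t : ℕ
  t = proj₁ (residue⇒square≡1 {p} residue)
  T : ℕ
  T = proj₁ (^-≡1-mod {t = t} (proj₂ (residue⇒square≡1 {p} residue)) (suc k))
  p²⁽ᵏ⁺¹⁾≡1+28T : (p * p) ^ suc k ≡ 1 + T * 28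
  p²⁽ᵏ⁺¹⁾≡1+28T = proj₂ (^-≡1-mod {t = t} (proj₂ (residue⇒square≡1 {p} residue)) (suc k))
  A : ℕ
  A = p ^ (2 * k + 1)
  even-power : p ^ (2 * k + 2) ≡ 1 + T * 28
  even-power = trans (cong (p ^_) (two-k+2 k)) (trans (sym (ℕ.^-*-assoc p 2 (suc k))) (trans (cong (_^ suc k) (cong (p *_) (ℕ.*-identityʳ p))) p²⁽ᵏ⁺¹⁾≡1+28T))
    where two-k+2 : ∀ k → 2 * k + 2 ≡ 2 * suc k
          two-k+2 = ℕ-Ring.solve-∀
  quotient : (122 * p ^ (2 * k + 2) + 4) / 7 ≡ 18 + 488 * T
  quotient = trans (cong (λ z → (122 * z + 4) / 7) even-power) (trans (cong (_/ 7) (multiple T)) (m*n/n≡m (18 + 488 * T) 7))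
    where multiple : ∀ T → 122 * (1 + T * 28) + 4 ≡ (18 + 488 * T) * 7
          multiple = ℕ-Ring.solve-∀
  index : 8 * A * n + (122 * p ^ (2 * k + 2) + 4) / 7 ≡ 8 * (A * n + 61 * T) + 18
  index = trans (cong (λ z → 8 * A * n + z) quotient) (regroup A n T)
    where regroup : ∀ A n T → 8 * A * n + (18 + 488 * T) ≡ 8 * (A * n + 61 * T) + 18
          regroup = ℕ-Ring.solve-∀
  cofactor : 28 * (A * n + 61 * T) + 61 ≡ A * (28 * n + 61 * p)
  cofactor = begin
    28 * (A * n + 61 * T) + 61       ≡⟨ regroup A n T ⟩
    28 * A * n + 61 * (1 + T * 28)   ≡⟨ cong (λ z → 28 * A * n + 61 * z) even-power ⟨
    28 * A * n + 61 * p ^ (2 * k + 2) ≡⟨ cong (λ z → 28 * A * n + 61 * p ^ z) (ℕ.+-suc (2 * k) 1) ⟩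
    28 * A * n + 61 * (p * A)        ≡⟨ factor A n p ⟩
    A * (28 * n + 61 * p)            ∎
    where
    regroup : ∀ A n T → 28 * (A * n + 61 * T) + 61 ≡ 28 * A * n + 61 * (1 + T * 28)
    regroup = ℕ-Ring.solve-∀
    factor : ∀ A n p → 28 * A * n + 61 * (p * A) ≡ A * (28 * n + 61 * p)
    factor = ℕ-Ring.solve-∀

7<p : Residue p → 7 < p
7<p {p} residue = ℕ.<-≤-trans (ℕ.m≤m+n 8 7) (residue⇒15≤ {p} residue)

residue⇒∤28 : Prime p → Residue p → ¬ p ∣ 28
residue⇒∤28 {p} pr residue p∣28 with euclidsLemma 4 7 pr p∣28
... | inj₁ p∣4 = ℕ.<⇒≱ (7<p residue) (ℕ.≤-trans (∣⇒≤ p∣4) (ℕ.m≤m+n 4 3))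
... | inj₂ p∣7 = ℕ.<⇒≱ (7<p residue) (∣⇒≤ p∣7)

residue⇒∤cofactor : Prime p → Residue p → ∀ {n} → ¬ p ∣ n → ¬ p ∣ 28 * n + 61 * p
residue⇒∤cofactor {p} pr residue {n} p∤n p∣cofactor with euclidsLemma 28 n pr p∣28n
  where
  p∣28n : p ∣ 28 * n
  p∣28n = ∣m+n∣m⇒∣n (subst (p ∣_) (ℕ.+-comm (28 * n) (61 * p)) p∣cofactor) (n∣m*n 61)
... | inj₁ p∣28 = residue⇒∤28 {p} pr residue p∣28
... | inj₂ p∣n  = p∤n p∣n

parity-c-vanishes : Prime p → Residue p → ∀ {n} → ¬ p ∣ n → ∀ k M →
                    28 * M + 61 ≡ p ^ (2 * k + 1) * (28 * n + 61 * p) → parity (c 11 3 (8 * M + 18)) ≡ false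
parity-c-vanishes {p} pr residue p∤n k M 28M+61≡ = trans (parity-c[8M+18] M) (ϑ₅·ϑ₆-vanishes {M} no-representation)
  where
  no-representation : ∀ X Y → X * X + Y * Y ≢ 28 * M + 61
  no-representation X Y X²+Y²≡28M+61 = residue⇒∤cofactor pr residue p∤n
    (sum-of-squares-cofactor pr (residue⇒≡3-mod-4 {p} residue) k {X} {Y} (trans X²+Y²≡28M+61 28M+61≡))

theorem5p3 : (p : ℕ) → Prime p → (p % 28 ≡ 15 ⊎ p % 28 ≡ 27) →
    (n k : ℕ) → ¬ (p ℕD.∣ n) →
    (+ 2) ℤD.∣ c 11 3 (8 * p ^ (2 * k + 1) * n + (122 * p ^ (2 * k + 2) + 4) / 7)
theorem5p3 p pr residue n k p∤n =
  let M , index , cofactor = progression {p} residue n k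
  in parity≡false⇒2∣ _ (trans (cong (parity ∘ c 11 3) index) (parity-c-vanishes pr residue p∤n k M cofactor))
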